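{- Let $\Sigma$ be a finite set. Every subset of $\Sigma^*$ that is quantifier-free definable (with parameters) in the structure $(\Sigma^*,\epsilon,\cdot)$ is a star-free language over $\Sigma$; in particular, it is regular.
   Context: $\Sigma^*$ is the free monoid of finite words over $\Sigma$, with empty word $\epsilon$ and concatenation. The star-free languages over $\Sigma$ form the smallest class of subsets of $\Sigma^*$ containing the finite sets and closed under Boolean combinations (complement relative to $\Sigma^*$, finite unions and intersections) and concatenation. The regular languages over $\Sigma$ form the smallest class of subsets of $\Sigma^*$ containing the finite sets and closed under union, concatenation and Kleene star. -}

module Defs where

open import Level using (0ℓ)
open import Data.Nat using (ℕ)
open import Data.Fin using (Fin)
open import Data.List using (List; []; _++_; concat)
open import Data.List.Membership.Propositional using (_∈_)
open import Data.List.Relation.Unary.All using (All)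
open import Data.Product using (Σ; ∃; ∃-syntax; _×_; _,_)
open import Data.Sum using (_⊎_)
open import Relation.Nullary using (¬_)
open import Relation.Binary.PropositionalEquality using (_≡_)
open import Function.Bundles using (_⇔_)

-- Words over an alphabet A: the free monoid A* (ε = [], · = _++_).
Word : Set → Set
Word A = List A

Lang : Set → Set₁
Lang A = Word A → Set

module _ {A : Set} where

  _≐_ : Lang A → Lang A → Set
  L ≐ M = ∀ w → L w ⇔ M w

  finLang : List (Word A) → Lang A
  finLang ws w = w ∈ ws

  compl : Lang A → Lang A
  compl L w = ¬ L w

  _∪ₗ_ : Lang A → Lang A → Lang A
  (L ∪ₗ M) w = L w ⊎ M w

  _∩ₗ_ : Lang A → Lang A → Lang A
  (L ∩ₗ M) w = L w × M w

  _·ₗ_ : Lang A → Lang A → Lang A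
  (L ·ₗ M) w = ∃[ u ] ∃[ v ] (w ≡ u ++ v × L u × M v)

  star : Lang A → Lang A
  star L w = ∃[ us ] (All L us × w ≡ concat us)

  -- Star-free languages: smallest class containing finite sets, closed under
  -- complement, finite unions/intersections, concatenation
  -- (and, since languages are predicates, under extensional equality).
  data StarFree : Lang A → Set₁ where
    sf-fin    : (ws : List (Word A)) → StarFree (finLang ws)
    sf-compl  : ∀ {L} → StarFree L → StarFree (compl L)
    sf-union  : ∀ {L M} → StarFree L → StarFree M → StarFree (L ∪ₗ M)
    sf-inter  : ∀ {L M} → StarFree L → StarFree M → StarFree (L ∩ₗ M)
    sf-concat : ∀ {L M} → StarFree L → StarFree M → StarFree (L ·ₗ M)
    sf-ext    : ∀ {L M} → L ≐ M → StarFree L → StarFree M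

  data Regular : Lang A → Set₁ where
    re-fin    : (ws : List (Word A)) → Regular (finLang ws)
    re-union  : ∀ {L M} → Regular L → Regular M → Regular (L ∪ₗ M)
    re-concat : ∀ {L M} → Regular L → Regular M → Regular (L ·ₗ M)
    re-star   : ∀ {L} → Regular L → Regular (star L)
    re-ext    : ∀ {L M} → L ≐ M → Regular L → Regular M

  data Term (k : ℕ) : Set where
    var : Fin k → Term k
    eps : Term k
    _∙_ : Term k → Term k → Term k

  data QFFormula (k : ℕ) : Set where
    ⊤f   : QFFormula k
    _≐t_ : Term k → Term k → QFFormula k
    ¬f_  : QFFormula k → QFFormula k
    _∧f_ : QFFormula k → QFFormula k → QFFormula k
    _∨f_ : QFFormula k → QFFormula k → QFFormula k

  ⟦_⟧t : ∀ {k} → Term k → (Fin k → Word A) → Word A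
  ⟦ var i ⟧t ρ = ρ i
  ⟦ eps ⟧t ρ = []
  ⟦ s ∙ t ⟧t ρ = ⟦ s ⟧t ρ ++ ⟦ t ⟧t ρ

  _⊨_ : ∀ {k} → (Fin k → Word A) → QFFormula k → Set
  ρ ⊨ ⊤f = Data.Unit.⊤ where import Data.Unit
  ρ ⊨ (s ≐t t) = ⟦ s ⟧t ρ ≡ ⟦ t ⟧t ρ
  ρ ⊨ (¬f φ) = ¬ (ρ ⊨ φ)
  ρ ⊨ (φ ∧f ψ) = (ρ ⊨ φ) × (ρ ⊨ ψ)
  ρ ⊨ (φ ∨f ψ) = (ρ ⊨ φ) ⊎ (ρ ⊨ ψ)

  -- Extend a parameter assignment by the distinguished variable x (index 0).
  _◃_ : ∀ {m} → Word A → (Fin m → Word A) → Fin (ℕ.suc m) → Word A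
  (w ◃ ρ) Fin.zero = w
  (w ◃ ρ) (Fin.suc i) = ρ i

  QFDefinable : Lang A → Set
  QFDefinable L =
    Σ ℕ λ m → Σ (QFFormula (ℕ.suc m)) λ φ → Σ (Fin m → Word A) λ as →
      ∀ w → L w ⇔ ((w ◃ as) ⊨ φ)

-- An atomic formula defines the solution set of a word equation A(x) = B(x) in one unknown.  If x occurs
-- a different number of times on the two sides, the solutions have bounded length.  Otherwise, after
-- cancelling common leading symbols, the equation reads x A′ = c x B′ with c a nonempty constant word.
-- Then every solution is a prefix of ρ^ω, where ρ is the primitive root of c, and whether the prefix of
-- length ℓ is a solution is eventually periodic in ℓ with period |ρ|: in each residue class the equation
-- evaluated at ρ^j is eventually constant in j, because a primitive word overlaps its own powers only
-- trivially.  Such a set is a finite set plus ρ^J ρ* T with T finite, and ρ* is star-free for primitive ρ.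
-- Boolean combinations are handled by carrying a deterministic automaton along with each star-free
-- language, and Kleene's theorem turns the automaton into a regular expression.

module Submission where

open import Defs
open import Data.Nat using (ℕ; zero; suc; _+_; _*_; _∸_; _⊔_; _≤_; _<_; z≤n; s≤s; s≤s⁻¹; _≤?_; _<?_; NonZero; ≢-nonZero⁻¹; >-nonZero⁻¹)
import Data.Nat as ℕ
open import Data.Nat.Properties hiding (_≟_)
open import Data.Nat.DivMod using (_%_; _/_; _mod_; m≡m%n+[m/n]*n; m%n<n; m%n%n≡m%n; [m+n]%n≡m%n; [m+kn]%n≡m%n; m<n⇒m%n≡m)
open import Data.Nat.Induction using (<-wellFounded)
open import Induction.WellFounded using (Acc; acc)
open import Data.Fin as Fin using (Fin; toℕ; fromℕ<)
open import Data.Fin.Properties using (toℕ<n; toℕ-fromℕ<; fromℕ<-cong; any?) renaming (_≟_ to _≟ᶠ_)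
open import Data.Bool using (Bool; true; false; T; not; _∧_; _∨_)
open import Data.Bool.Properties using (T-∧; T-∨; T?)
open import Data.Maybe using (Maybe; just; nothing; is-just)
import Data.Maybe.Properties as Maybe
open import Data.Unit using (⊤; tt)
open import Data.Product using (∃-syntax; _×_; _,_; proj₁; proj₂)
open import Data.Sum using (_⊎_; inj₁; inj₂; [_,_]′)
import Data.Sum as Sum
open import Data.List using (List; []; _∷_; _++_; _∷ʳ_; [_]; length; lookup; map; concat; filter; foldl; upTo; allFin; applyUpTo; cartesianProduct; take; drop; initLast; _∷ʳ′_)
open import Data.List.Properties using (≡-dec; ∷-injective; ∷-injectiveˡ; ∷-injectiveʳ; ∷ʳ-injective; ++-assoc; ++-identityʳ; ++-cancelˡ; length-++; length-++-comm; foldl-++; applyUpTo-∷ʳ; length-applyUpTo; take++drop≡id)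
open import Data.List.Reverse using (Reverse; reverseView; []; _∶_∶ʳ_)
open import Data.List.Membership.Propositional using (_∈_; find; lose)
open import Data.List.Membership.Propositional.Properties using (∈-concat⁺′; ∈-map⁺; ∈-map⁻; ∈-allFin; ∈-upTo⁺; ∈-filter⁺; ∈-filter⁻; ∈-cartesianProduct⁺)
open import Data.List.Relation.Unary.Any as Any using (Any; here; there)
open import Data.List.Relation.Unary.All using (All; []; _∷_)
open import Data.Empty using (⊥-elim)
open import Function using (_∘_; id; case_of_)
open import Function.Bundles using (_⇔_; mk⇔; Equivalence)
open import Function.Construct.Composition using (_⇔-∘_)
open import Function.Construct.Symmetry using (⇔-sym)
open import Relation.Nullary using (¬_; Dec; yes; no)
open import Relation.Nullary.Decidable using (_×-dec_; isYes; toWitness; fromWitness)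
open import Relation.Unary using (Decidable)
open import Relation.Binary.Definitions using (DecidableEquality; tri<; tri≈; tri>)
open import Relation.Binary.PropositionalEquality hiding (J; [_])

-- Combinatorics on words

module _ {A : Set} where

  ≐-sym : {L M : Lang A} → L ≐ M → M ≐ L
  ≐-sym L≐M w = ⇔-sym (L≐M w)

  infix 4 _⊑_
  _⊑_ : List A → List A → Set
  u ⊑ w = ∃[ z ] w ≡ u ++ z

  ++-levi : ∀ (u v u′ v′ : List A) → u ++ v ≡ u′ ++ v′ →
            (∃[ m ] u′ ≡ u ++ m × v ≡ m ++ v′) ⊎ (∃[ m ] u ≡ u′ ++ m × v′ ≡ m ++ v)
  ++-levi []      v u′       v′ e = inj₁ (u′ , refl , e)
  ++-levi (a ∷ u) v []       v′ e = inj₂ (a ∷ u , refl , sym e)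
  ++-levi (a ∷ u) v (b ∷ u′) v′ e with refl , e′ ← ∷-injective e with ++-levi u v u′ v′ e′
  ... | inj₁ (m , u′≡um , v≡mv′) = inj₁ (m , cong (a ∷_) u′≡um , v≡mv′)
  ... | inj₂ (m , u≡u′m , v′≡mv) = inj₂ (m , cong (a ∷_) u≡u′m , v′≡mv)

  length≡0⇒[] : ∀ {m : List A} → length m ≡ 0 → m ≡ []
  length≡0⇒[] {[]} _ = refl

  ≢[]⇒0<length : ∀ {u : List A} → u ≢ [] → 0 < length u
  ≢[]⇒0<length {[]}    u≢[] = ⊥-elim (u≢[] refl)
  ≢[]⇒0<length {_ ∷ _} _    = s≤s z≤n

  length-<-++ˡ : ∀ {r : List A} u → r ≢ [] → length u < length (r ++ u)
  length-<-++ˡ {r} u r≢[] = ≤-trans (m<n+m (length u) (≢[]⇒0<length r≢[])) (≤-reflexive (sym (length-++ r)))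

  length-<-++ʳ : ∀ r {t : List A} → t ≢ [] → length r < length (r ++ t)
  length-<-++ʳ r t≢[] = ≤-trans (m<m+n (length r) (≢[]⇒0<length t≢[])) (≤-reflexive (sym (length-++ r)))

  length-∷ʳ : ∀ (x : List A) a → length (x ∷ʳ a) ≡ suc (length x)
  length-∷ʳ x a = trans (length-++ x) (+-comm (length x) 1)

  ⊑-refl : ∀ u → u ⊑ u
  ⊑-refl u = [] , sym (++-identityʳ u)

  ⊑-++ : ∀ u v → u ⊑ u ++ v
  ⊑-++ u v = v , refl

  ⊑-trans : ∀ {u v w} → u ⊑ v → v ⊑ w → u ⊑ w
  ⊑-trans {u} (z , refl) (z′ , refl) = z ++ z′ , ++-assoc u z z′

  ⊑⇒length≤ : ∀ {u w} → u ⊑ w → length u ≤ length w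
  ⊑⇒length≤ {u} (z , refl) = ≤-trans (m≤m+n (length u) (length z)) (≤-reflexive (sym (length-++ u)))

  ⊑-cancelˡ : ∀ c {u w} → c ++ u ⊑ c ++ w → u ⊑ w
  ⊑-cancelˡ c {u} (z , e) = z , ++-cancelˡ c _ _ (trans e (++-assoc c u z))

  ⊑-congˡ : ∀ c {u w} → u ⊑ w → c ++ u ⊑ c ++ w
  ⊑-congˡ c {u} (z , refl) = z , sym (++-assoc c u z)

  ++-length≤⇒[] : ∀ u {z : List A} → length (u ++ z) ≤ length u → z ≡ []
  ++-length≤⇒[] u {z} uz≤u = length≡0⇒[] (n≤0⇒n≡0 (+-cancelˡ-≤ (length u) (length z) 0 (begin
    length u + length z ≡⟨ length-++ u ⟨
    length (u ++ z)     ≤⟨ uz≤u ⟩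
    length u            ≡⟨ +-identityʳ (length u) ⟨
    length u + 0        ∎)))
    where open ≤-Reasoning

  ⊑-by-length : ∀ {u v w} → u ⊑ w → v ⊑ w → length u ≤ length v → u ⊑ v
  ⊑-by-length {u} {v} (z , refl) (z′ , e) u≤v with ++-levi u z v z′ e
  ... | inj₁ (m , v≡um , _) = m , v≡um
  ... | inj₂ (m , refl , _) with refl ← ++-length≤⇒[] v u≤v = [] , sym (trans (++-identityʳ (v ++ [])) (++-identityʳ v))

  ⊑-length-≡ : ∀ {u v w} → u ⊑ w → v ⊑ w → length u ≡ length v → u ≡ v
  ⊑-length-≡ {u} u⊑w v⊑w e with z , refl ← ⊑-by-length u⊑w v⊑w (≤-reflexive e)
                            with refl ← ++-length≤⇒[] u (≤-reflexive (sym e)) = sym (++-identityʳ u)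

  ++-suffix-by-length : ∀ (u v u′ v′ : List A) → u ++ v ≡ u′ ++ v′ → length v ≡ length v′ → v ≡ v′
  ++-suffix-by-length u v u′ v′ e |v|≡|v′| = ++-cancelˡ u v v′ (trans e (cong (_++ v′) (sym u≡u′)))
    where
    u≡u′ : u ≡ u′
    u≡u′ = ⊑-length-≡ (v , refl) (v′ , e) (+-cancelʳ-≡ (length v) _ _
             (trans (sym (length-++ u)) (trans (cong length e) (trans (length-++ u′) (cong (length u′ +_) (sym |v|≡|v′|))))))

  infixr 8 _^_
  _^_ : List A → ℕ → List A
  ρ ^ zero  = []
  ρ ^ suc k = ρ ++ ρ ^ k

  ^-+ : ∀ ρ i j → ρ ^ (i + j) ≡ ρ ^ i ++ ρ ^ j
  ^-+ ρ zero    j = refl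
  ^-+ ρ (suc i) j = trans (cong (ρ ++_) (^-+ ρ i j)) (sym (++-assoc ρ (ρ ^ i) (ρ ^ j)))

  ^-comm : ∀ ρ i j → ρ ^ i ++ ρ ^ j ≡ ρ ^ j ++ ρ ^ i
  ^-comm ρ i j = trans (sym (^-+ ρ i j)) (trans (cong (ρ ^_) (+-comm i j)) (^-+ ρ j i))

  ^-sucʳ : ∀ ρ k → ρ ^ suc k ≡ ρ ^ k ++ ρ
  ^-sucʳ ρ k = trans (cong (_++ ρ ^ k) (sym (++-identityʳ ρ))) (trans (^-comm ρ 1 k) (cong (ρ ^ k ++_) (++-identityʳ ρ)))

  ^-* : ∀ ρ i j → (ρ ^ i) ^ j ≡ ρ ^ (j * i)
  ^-* ρ i zero    = refl
  ^-* ρ i (suc j) = trans (cong (ρ ^ i ++_) (^-* ρ i j)) (sym (^-+ ρ i (j * i)))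

  []^ : ∀ k → [] ^ k ≡ []
  []^ zero    = refl
  []^ (suc k) = []^ k

  ^-nonempty : ∀ ρ k → ρ ^ k ≢ [] → ∃[ k′ ] k ≡ suc k′
  ^-nonempty ρ zero    h = ⊥-elim (h refl)
  ^-nonempty ρ (suc k) h = k , refl

  ^-length-≥ : ∀ {ρ} → ρ ≢ [] → ∀ k → k ≤ length (ρ ^ k)
  ^-length-≥ ρ≢[] zero    = z≤n
  ^-length-≥ {ρ} ρ≢[] (suc k) = ≤-trans (+-mono-≤ (≢[]⇒0<length ρ≢[]) (^-length-≥ ρ≢[] k)) (≤-reflexive (sym (length-++ ρ)))

  ⊑-iterate : ∀ {c x : List A} → x ⊑ c ++ x → ∀ m → x ⊑ c ^ m ++ x
  ⊑-iterate {c} {x} _   zero    = ⊑-refl x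
  ⊑-iterate {c} {x} x⊑cx (suc m) =
    subst (x ⊑_) (sym (++-assoc c (c ^ m) x)) (⊑-trans x⊑cx (⊑-congˡ c (⊑-iterate x⊑cx m)))

  -- Lyndon–Schützenberger: the shorter word is a prefix of the longer one, and cancelling it preserves commutation.
  commute⇒powers : ∀ (r t : List A) → r ++ t ≡ t ++ r → ∃[ z ] ∃[ a ] ∃[ b ] r ≡ z ^ a × t ≡ z ^ b
  commute⇒powers r t = go r t (<-wellFounded _)
    where
    shorter-prefix : ∀ r t → r ++ t ≡ t ++ r → length r ≤ length t →
                     ∃[ t′ ] t ≡ r ++ t′ × r ++ t′ ≡ t′ ++ r
    shorter-prefix r t e r≤t with t′ , refl ← ⊑-by-length (⊑-++ r t) (subst (t ⊑_) (sym e) (⊑-++ t r)) r≤t =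
      t′ , refl , ++-cancelˡ r _ _ (trans e (++-assoc r t′ r))

    go : ∀ (r t : List A) → Acc _<_ (length (r ++ t)) → r ++ t ≡ t ++ r →
         ∃[ z ] ∃[ a ] ∃[ b ] r ≡ z ^ a × t ≡ z ^ b
    go []      t       _         _ = t , 0 , 1 , refl , sym (++-identityʳ t)
    go (x ∷ r) []      _         _ = x ∷ r , 1 , 0 , sym (++-identityʳ _) , refl
    go (x ∷ r) (y ∷ t) (acc rec) e with length (x ∷ r) ≤? length (y ∷ t)
    ... | yes r≤t =
      let t′ , t≡rt′ , e′ = shorter-prefix (x ∷ r) (y ∷ t) e r≤t
          shorter : length (x ∷ r ++ t′) < length (x ∷ r ++ y ∷ t)
          shorter = subst (_< length (x ∷ r ++ y ∷ t)) (cong length t≡rt′) (length-<-++ˡ {x ∷ r} (y ∷ t) λ ())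
          z , a , b , r≡zᵃ , t′≡zᵇ = go (x ∷ r) t′ (rec shorter) e′
      in z , a , a + b , r≡zᵃ , trans t≡rt′ (trans (cong₂ _++_ r≡zᵃ t′≡zᵇ) (sym (^-+ z a b)))
    ... | no r≰t =
      let r′ , r≡tr′ , e′ = shorter-prefix (y ∷ t) (x ∷ r) (sym e) (<⇒≤ (≰⇒> r≰t))
          shorter : length (y ∷ t ++ r′) < length (x ∷ r ++ y ∷ t)
          shorter = subst (_< length (x ∷ r ++ y ∷ t)) (cong length r≡tr′) (length-<-++ʳ (x ∷ r) {y ∷ t} λ ())
          z , a , b , t≡zᵃ , r′≡zᵇ = go (y ∷ t) r′ (rec shorter) e′
      in z , a + b , a , trans r≡tr′ (trans (cong₂ _++_ t≡zᵃ r′≡zᵇ) (sym (^-+ z a b))) , t≡zᵃ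

  -- Primitivity in its conjugacy form (no proper rotation of ρ equals ρ); equivalent to not being a proper power.
  Primitive : List A → Set
  Primitive ρ = ∀ r t → r ≢ [] → t ≢ [] → r ++ t ≡ ρ → t ++ r ≢ ρ

module _ {A : Set} (_≟_ : DecidableEquality A) where

  _⊑?_ : ∀ (u w : List A) → Dec (u ⊑ w)
  []      ⊑? w       = yes (w , refl)
  (a ∷ u) ⊑? []      = no λ ()
  (a ∷ u) ⊑? (b ∷ w) with a ≟ b | u ⊑? w
  ... | yes refl | yes (z , e) = yes (z , cong (a ∷_) e)
  ... | yes refl | no u⋢w      = no λ (z , e) → u⋢w (z , proj₂ (∷-injective e))
  ... | no a≢b   | _           = no λ (z , e) → a≢b (sym (proj₁ (∷-injective e)))

  private
    infix 4 _≟ᴸ_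
    _≟ᴸ_ : DecidableEquality (List A)
    _≟ᴸ_ = ≡-dec _≟_

    take-length-++ : ∀ (r t : List A) → take (length r) (r ++ t) ≡ r
    take-length-++ []      t = refl
    take-length-++ (x ∷ r) t = cong (x ∷_) (take-length-++ r t)

    drop-length-++ : ∀ (r t : List A) → drop (length r) (r ++ t) ≡ t
    drop-length-++ []      t = refl
    drop-length-++ (x ∷ r) t = drop-length-++ r t

  IsRotation : List A → ℕ → Set
  IsRotation c i = 0 < i × drop i c ++ take i c ≡ c

  primitive-or-rotation : ∀ (c : List A) →
    Primitive c ⊎ ∃[ r ] ∃[ t ] r ≢ [] × t ≢ [] × r ++ t ≡ c × t ++ r ≡ c
  primitive-or-rotation c with any? (λ (i : Fin (length c)) → (0 <? toℕ i) ×-dec (drop (toℕ i) c ++ take (toℕ i) c ≟ᴸ c))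
  ... | yes (i , 0<i , e) =
    inj₂ (take (toℕ i) c , drop (toℕ i) c , take≢[] c (toℕ i) 0<i (toℕ<n i) , drop≢[] c (toℕ i) (toℕ<n i) ,
          take++drop≡id (toℕ i) c , e)
    where
    take≢[] : ∀ c i → 0 < i → i < length c → take i c ≢ []
    take≢[] (x ∷ c) (suc i) _ _ ()
    drop≢[] : ∀ c i → i < length c → drop i c ≢ []
    drop≢[] (x ∷ c) zero    _         ()
    drop≢[] (x ∷ c) (suc i) (s≤s i<c) = drop≢[] c i i<c
  ... | no no-rotation = inj₁ λ r t r≢[] t≢[] rt≡c tr≡c → no-rotation (rotation-index r t r≢[] t≢[] rt≡c tr≡c)
    where
    rotation-index : ∀ r t → r ≢ [] → t ≢ [] → r ++ t ≡ c → t ++ r ≡ c → ∃[ i ] IsRotation c (toℕ {length c} i)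
    rotation-index r t r≢[] t≢[] refl tr≡c = fromℕ< r<c , subst (IsRotation (r ++ t)) (sym (toℕ-fromℕ< r<c))
        (≢[]⇒0<length r≢[] , trans (cong₂ _++_ (drop-length-++ r t) (take-length-++ r t)) tr≡c)
      where
      r<c : length r < length (r ++ t)
      r<c = length-<-++ʳ r t≢[]

  primitive-root : ∀ c → c ≢ [] → ∃[ ρ ] ∃[ j ] ρ ≢ [] × Primitive ρ × c ≡ ρ ^ j
  primitive-root c = go c (<-wellFounded _)
    where
    go : ∀ c → Acc _<_ (length c) → c ≢ [] → ∃[ ρ ] ∃[ j ] ρ ≢ [] × Primitive ρ × c ≡ ρ ^ j
    go c (acc rec) c≢[] with primitive-or-rotation c
    ... | inj₁ prim = c , 1 , c≢[] , prim , sym (++-identityʳ c)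
    ... | inj₂ (r , t , r≢[] , t≢[] , refl , tr≡rt)
      with z , a , b , refl , refl ← commute⇒powers r t (sym tr≡rt)
      with a′ , refl ← ^-nonempty z a r≢[] =
      let ρ , j , ρ≢[] , prim , z≡ρʲ = go z (rec z<c) z≢[]
      in ρ , (a + b) * j , ρ≢[] , prim , (begin
        z ^ a ++ z ^ b    ≡⟨ ^-+ z a b ⟨
        z ^ (a + b)       ≡⟨ cong (_^ (a + b)) z≡ρʲ ⟩
        (ρ ^ j) ^ (a + b) ≡⟨ ^-* ρ j (a + b) ⟩
        ρ ^ ((a + b) * j) ∎)
      where
      open ≡-Reasoning
      z≢[] : z ≢ []
      z≢[] refl = r≢[] ([]^ a)
      z<c : length z < length (z ^ a ++ z ^ b)
      z<c = ≤-<-trans (⊑⇒length≤ (⊑-++ z (z ^ a′))) (length-<-++ʳ (z ^ a) t≢[])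

  strip-powers : ∀ ρ → ρ ≢ [] → ∀ c → ∃[ i ] ∃[ c′ ] c ≡ ρ ^ i ++ c′ × ¬ ρ ⊑ c′
  strip-powers ρ ρ≢[] c = go c (<-wellFounded _)
    where
    go : ∀ c → Acc _<_ (length c) → ∃[ i ] ∃[ c′ ] c ≡ ρ ^ i ++ c′ × ¬ ρ ⊑ c′
    go c (acc rec) with ρ ⊑? c
    ... | no ρ⋢c = 0 , c , refl , ρ⋢c
    ... | yes (c₁ , refl) =
      let i , c′ , c₁≡ρⁱc′ , ρ⋢c′ = go c₁ (rec (length-<-++ˡ c₁ ρ≢[]))
      in suc i , c′ , trans (cong (ρ ++_) c₁≡ρⁱc′) (sym (++-assoc ρ (ρ ^ i) c′)) , ρ⋢c′

module _ {A : Set} where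

  applyUpTo-+ : ∀ (f : ℕ → A) a b → applyUpTo f (a + b) ≡ applyUpTo f a ++ applyUpTo (f ∘ (a +_)) b
  applyUpTo-+ f zero    b = refl
  applyUpTo-+ f (suc a) b = cong (f 0 ∷_) (applyUpTo-+ (f ∘ suc) a b)

  applyUpTo-cong : ∀ (f g : ℕ → A) k → (∀ i → i < k → f i ≡ g i) → applyUpTo f k ≡ applyUpTo g k
  applyUpTo-cong f g zero    _   = refl
  applyUpTo-cong f g (suc k) f≗g =
    cong₂ _∷_ (f≗g 0 (s≤s z≤n)) (applyUpTo-cong (f ∘ suc) (g ∘ suc) k (λ i i<k → f≗g (suc i) (s≤s i<k)))

  applyUpTo-lookup : ∀ (xs : List A) f → (∀ i (i<xs : i < length xs) → f i ≡ lookup xs (fromℕ< i<xs)) →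
                     applyUpTo f (length xs) ≡ xs
  applyUpTo-lookup []       f _  = refl
  applyUpTo-lookup (x ∷ xs) f f≗ =
    cong₂ _∷_ (f≗ 0 (s≤s z≤n)) (applyUpTo-lookup xs (f ∘ suc) (λ i i<xs → f≗ (suc i) (s≤s i<xs)))

  applyUpTo-at : ∀ (f : ℕ → A) N y c z → applyUpTo f N ≡ y ++ c ∷ z → c ≡ f (length y)
  applyUpTo-at f (suc N) []      c z e = sym (∷-injectiveˡ e)
  applyUpTo-at f (suc N) (x ∷ y) c z e = applyUpTo-at (f ∘ suc) N y c z (∷-injectiveʳ e)

  ⊑-applyUpTo : ∀ f N {x} → x ⊑ applyUpTo f N → x ≡ applyUpTo f (length x)
  ⊑-applyUpTo f N {x} x⊑ =
    let o , x+o≡N = m≤n⇒∃[o]m+o≡n (≤-trans (⊑⇒length≤ x⊑) (≤-reflexive (length-applyUpTo f N)))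
    in ⊑-length-≡ x⊑ (_ , trans (cong (applyUpTo f) (sym x+o≡N)) (applyUpTo-+ f (length x) o))
                  (sym (length-applyUpTo f (length x)))

module Periodic {A : Set} (ρ : List A) {{_ : NonZero (length ρ)}} where

  p : ℕ
  p = length ρ

  ω : ℕ → A
  ω i = lookup ρ (i mod p)

  ω↾_ : ℕ → List A
  ω↾ ℓ = applyUpTo ω ℓ

  Prefixω : List A → Set
  Prefixω x = x ≡ ω↾ length x

  ω-% : ∀ i → ω (i % p) ≡ ω i
  ω-% i = cong (lookup ρ) (fromℕ<-cong _ _ (m%n%n≡m%n i p) _ _)

  ω-+p : ∀ i → ω (p + i) ≡ ω i
  ω-+p i = cong (lookup ρ) (fromℕ<-cong _ _ (trans (cong (_% p) (+-comm p i)) ([m+n]%n≡m%n i p)) _ _)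

  suc-% : ∀ m → suc m % p ≡ suc (m % p) % p
  suc-% m = trans (cong (λ k → suc k % p) (m≡m%n+[m/n]*n m p)) ([m+kn]%n≡m%n (suc (m % p)) (m / p) p)

  ω↾p : ω↾ p ≡ ρ
  ω↾p = applyUpTo-lookup ρ ω (λ i i<p → cong (lookup ρ) (fromℕ<-cong _ _ (m<n⇒m%n≡m i<p) _ i<p))

  ω↾-p+ : ∀ ℓ → ω↾ (p + ℓ) ≡ ρ ++ ω↾ ℓ
  ω↾-p+ ℓ = trans (applyUpTo-+ ω p ℓ) (cong₂ _++_ ω↾p (applyUpTo-cong _ ω ℓ (λ i _ → ω-+p i)))

  ω↾-*p+ : ∀ k ℓ → ω↾ (k * p + ℓ) ≡ ρ ^ k ++ ω↾ ℓ
  ω↾-*p+ zero    ℓ = refl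
  ω↾-*p+ (suc k) ℓ = begin
    ω↾ (p + k * p + ℓ)     ≡⟨ cong ω↾_ (+-assoc p (k * p) ℓ) ⟩
    ω↾ (p + (k * p + ℓ))   ≡⟨ ω↾-p+ (k * p + ℓ) ⟩
    ρ ++ ω↾ (k * p + ℓ)    ≡⟨ cong (ρ ++_) (ω↾-*p+ k ℓ) ⟩
    ρ ++ ρ ^ k ++ ω↾ ℓ     ≡⟨ ++-assoc ρ (ρ ^ k) (ω↾ ℓ) ⟨
    (ρ ++ ρ ^ k) ++ ω↾ ℓ   ∎
    where open ≡-Reasoning

  ω↾-*p : ∀ k → ω↾ (k * p) ≡ ρ ^ k
  ω↾-*p k = trans (cong ω↾_ (sym (+-identityʳ (k * p)))) (trans (ω↾-*p+ k 0) (++-identityʳ (ρ ^ k)))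

  Prefixω-∷ʳ⁻ : ∀ x a → Prefixω (x ∷ʳ a) → Prefixω x × a ≡ ω (length x)
  Prefixω-∷ʳ⁻ x a h = ∷ʳ-injective x (ω↾ length x)
    (trans h (trans (cong ω↾_ (length-∷ʳ x a)) (sym (applyUpTo-∷ʳ ω (length x)))))

  Prefixω-∷ʳ⁺ : ∀ x a → Prefixω x → a ≡ ω (length x) → Prefixω (x ∷ʳ a)
  Prefixω-∷ʳ⁺ x a x≡ a≡ = trans (cong₂ _∷ʳ_ x≡ a≡)
    (trans (applyUpTo-∷ʳ ω (length x)) (cong ω↾_ (sym (length-∷ʳ x a))))

  ρ≢[] : ρ ≢ []
  ρ≢[] e = ≢-nonZero⁻¹ p (cong length e)

  ⊑-power⇒Prefixω : ∀ k x → x ⊑ ρ ^ suc k ++ x → Prefixω x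
  ⊑-power⇒Prefixω k x x⊑cx = ⊑-applyUpTo ω (N * p) (subst (x ⊑_) (sym (ω↾-*p N)) x⊑ρᴺ)
    where
    N : ℕ
    N = length x * suc k
    x⊑ρᴺx : x ⊑ ρ ^ N ++ x
    x⊑ρᴺx = subst (λ w → x ⊑ w ++ x) (^-* ρ (suc k) (length x)) (⊑-iterate x⊑cx (length x))
    x⊑ρᴺ : x ⊑ ρ ^ N
    x⊑ρᴺ = ⊑-by-length x⊑ρᴺx (⊑-++ (ρ ^ N) x) (≤-trans (m≤m*n (length x) (suc k)) (^-length-≥ ρ≢[] N))

-- Star-free languages and finite automata

module _ {n : ℕ} where

  Σ* : Lang (Fin n)
  Σ* = compl (finLang [])

  ∈Σ* : ∀ w → Σ* w
  ∈Σ* w ()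

  words-of-length : ℕ → List (Word (Fin n))
  words-of-length zero    = [ [] ]
  words-of-length (suc k) = concat (map (λ a → map (a ∷_) (words-of-length k)) (allFin n))

  ∈-words-of-length : ∀ w → w ∈ words-of-length (length w)
  ∈-words-of-length []      = here refl
  ∈-words-of-length (a ∷ w) =
    ∈-concat⁺′ (∈-map⁺ (a ∷_) (∈-words-of-length w)) (∈-map⁺ (λ a → map (a ∷_) (words-of-length (length w))) (∈-allFin a))

  words≤ : ℕ → List (Word (Fin n))
  words≤ K = concat (map words-of-length (upTo (suc K)))

  ∈-words≤ : ∀ K w → length w ≤ K → w ∈ words≤ K
  ∈-words≤ K w w≤K = ∈-concat⁺′ (∈-words-of-length w) (∈-map⁺ words-of-length (∈-upTo⁺ (s≤s w≤K)))

  Bounded : Lang (Fin n) → ℕ → Set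
  Bounded L K = ∀ w → L w → length w ≤ K

  bounded-starFree : ∀ {L} K → Decidable L → Bounded L K → StarFree L
  bounded-starFree {L} K L? bounded = sf-ext finite≐L (sf-fin (filter L? (words≤ K)))
    where
    finite≐L : finLang (filter L? (words≤ K)) ≐ L
    finite≐L w = mk⇔ (proj₂ ∘ ∈-filter⁻ L?) (λ w∈L → ∈-filter⁺ L? (∈-words≤ K w (bounded w w∈L)) w∈L)

  -- A deterministic finite automaton, presented through the state it reaches on each word.
  record Recognizer (L : Lang (Fin n)) : Set₁ where
    field
      Q          : Set
      _≟_        : DecidableEquality Q
      state      : Word (Fin n) → Q
      states     : List Q
      ∈-states   : ∀ w → state w ∈ states
      δ          : Q → Fin n → Q
      state-∷ʳ   : ∀ w a → state (w ∷ʳ a) ≡ δ (state w) a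
      accepting  : Q → Bool
      recognizes : ∀ w → L w ⇔ T (accepting (state w))

  recognizer-ext : ∀ {L M} → L ≐ M → Recognizer L → Recognizer M
  recognizer-ext L≐M R = record
    { Q = Q ; _≟_ = _≟_ ; state = state ; states = states ; ∈-states = ∈-states ; δ = δ ; state-∷ʳ = state-∷ʳ
    ; accepting = accepting ; recognizes = λ w → recognizes w ⇔-∘ ⇔-sym (L≐M w) }
    where open Recognizer R

  recognizer-compl : ∀ {L} → Recognizer L → Recognizer (compl L)
  recognizer-compl R = record
    { Q = Q ; _≟_ = _≟_ ; state = state ; states = states ; ∈-states = ∈-states ; δ = δ ; state-∷ʳ = state-∷ʳ
    ; accepting  = not ∘ accepting
    ; recognizes = λ w → T-not ⇔-∘ mk⇔ (λ ∉L → ∉L ∘ from (recognizes w)) (λ ∉T → ∉T ∘ to (recognizes w))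
    }
    where
    open Recognizer R
    open Equivalence
    T-not : ∀ {b} → (¬ T b) ⇔ T (not b)
    T-not {true}  = mk⇔ (λ ¬T → ¬T tt) (λ ())
    T-not {false} = mk⇔ (λ _ → tt) (λ _ ())

  recognizer-product : ∀ {L M N} (_⊙_ : Bool → Bool → Bool) → Recognizer L → Recognizer M →
    (∀ w {b c} → L w ⇔ T b → M w ⇔ T c → N w ⇔ T (b ⊙ c)) → Recognizer N
  recognizer-product _⊙_ R S combine = record
    { Q          = R.Q × S.Q
    ; _≟_        = λ (q , r) (q′ , r′) → Dec-× (q R.≟ q′) (r S.≟ r′)
    ; state      = λ w → R.state w , S.state w
    ; states     = cartesianProduct R.states S.states
    ; ∈-states   = λ w → ∈-cartesianProduct⁺ (R.∈-states w) (S.∈-states w)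
    ; δ          = λ (q , r) a → R.δ q a , S.δ r a
    ; state-∷ʳ   = λ w a → cong₂ _,_ (R.state-∷ʳ w a) (S.state-∷ʳ w a)
    ; accepting  = λ (q , r) → R.accepting q ⊙ S.accepting r
    ; recognizes = λ w → combine w (R.recognizes w) (S.recognizes w)
    }
    where
    module R = Recognizer R
    module S = Recognizer S
    Dec-× : ∀ {X Y : Set} {x x′ : X} {y y′ : Y} → Dec (x ≡ x′) → Dec (y ≡ y′) → Dec ((x , y) ≡ (x′ , y′))
    Dec-× (yes refl) (yes refl) = yes refl
    Dec-× (no x≢x′)  _          = no (x≢x′ ∘ cong proj₁)
    Dec-× _          (no y≢y′)  = no (y≢y′ ∘ cong proj₂)

  recognizer-∩ : ∀ {L M} → Recognizer L → Recognizer M → Recognizer (L ∩ₗ M)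
  recognizer-∩ R S = recognizer-product _∧_ R S λ w L⇔ M⇔ →
    ⇔-sym T-∧ ⇔-∘ mk⇔ (λ (l , m) → to L⇔ l , to M⇔ m) (λ (l , m) → from L⇔ l , from M⇔ m)
    where open Equivalence

  recognizer-∪ : ∀ {L M} → Recognizer L → Recognizer M → Recognizer (L ∪ₗ M)
  recognizer-∪ R S = recognizer-product _∨_ R S λ w L⇔ M⇔ →
    ⇔-sym T-∨ ⇔-∘ mk⇔ (Sum.map (to L⇔) (to M⇔)) (Sum.map (from L⇔) (from M⇔))
    where open Equivalence

  recognizer-Σ* : Recognizer Σ*
  recognizer-Σ* = record
    { Q = ⊤ ; _≟_ = λ _ _ → yes refl ; state = λ _ → tt ; states = [ tt ] ; ∈-states = λ _ → here refl
    ; δ = λ _ _ → tt ; state-∷ʳ = λ _ _ → refl ; accepting = λ _ → true ; recognizes = λ w → mk⇔ _ (λ _ → ∈Σ* w) }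

  bounded-recognizer : ∀ {L} K → Decidable L → Bounded L K → Recognizer L
  bounded-recognizer {L} K L? bounded = record
    { Q = Maybe (Word (Fin n)) ; _≟_ = Maybe.≡-dec (≡-dec _≟ᶠ_)
    ; state = state ; states = nothing ∷ map just (words≤ K) ; ∈-states = ∈-states
    ; δ = δ ; state-∷ʳ = state-∷ʳ ; accepting = accepting ; recognizes = recognizes }
    where
    state : Word (Fin n) → Maybe (Word (Fin n))
    state w with length w ≤? K
    ... | yes _ = just w
    ... | no _  = nothing
    δ : Maybe (Word (Fin n)) → Fin n → Maybe (Word (Fin n))
    δ nothing  a = nothing
    δ (just u) a = state (u ∷ʳ a)
    accepting : Maybe (Word (Fin n)) → Bool
    accepting nothing  = false
    accepting (just u) = isYes (L? u)
    state-∷ʳ : ∀ w a → state (w ∷ʳ a) ≡ δ (state w) a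
    state-∷ʳ w a with length w ≤? K
    ... | yes _ = refl
    ... | no w≰K with length (w ∷ʳ a) ≤? K
    ...   | yes wa≤K = ⊥-elim (w≰K (≤-trans (n≤1+n _) (subst (_≤ K) (length-∷ʳ w a) wa≤K)))
    ...   | no _     = refl
    ∈-states : ∀ w → state w ∈ nothing ∷ map just (words≤ K)
    ∈-states w with length w ≤? K
    ... | yes w≤K = there (∈-map⁺ just (∈-words≤ K w w≤K))
    ... | no _    = here refl
    recognizes : ∀ w → L w ⇔ T (accepting (state w))
    recognizes w with length w ≤? K
    ... | no w≰K = mk⇔ (λ w∈L → w≰K (bounded w w∈L)) (λ ())
    ... | yes _ with L? w
    ...   | yes w∈L = mk⇔ _ (λ _ → w∈L)
    ...   | no w∉L  = mk⇔ w∉L (λ ())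

  StarFreeRecognizable : Lang (Fin n) → Set₁
  StarFreeRecognizable L = StarFree L × Recognizer L

  sfr-ext : ∀ {L M} → L ≐ M → StarFreeRecognizable L → StarFreeRecognizable M
  sfr-ext L≐M (sf , R) = sf-ext L≐M sf , recognizer-ext L≐M R

  sfr-compl : ∀ {L} → StarFreeRecognizable L → StarFreeRecognizable (compl L)
  sfr-compl (sf , R) = sf-compl sf , recognizer-compl R

  sfr-∪ : ∀ {L M} → StarFreeRecognizable L → StarFreeRecognizable M → StarFreeRecognizable (L ∪ₗ M)
  sfr-∪ (sf , R) (sf′ , R′) = sf-union sf sf′ , recognizer-∪ R R′

  sfr-∩ : ∀ {L M} → StarFreeRecognizable L → StarFreeRecognizable M → StarFreeRecognizable (L ∩ₗ M)
  sfr-∩ (sf , R) (sf′ , R′) = sf-inter sf sf′ , recognizer-∩ R R′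

  sfr-bounded : ∀ {L} K → Decidable L → Bounded L K → StarFreeRecognizable L
  sfr-bounded K L? bounded = bounded-starFree K L? bounded , bounded-recognizer K L? bounded

  sfr-Σ* : StarFreeRecognizable Σ*
  sfr-Σ* = sf-compl (sf-fin []) , recognizer-Σ*

  sfr-∅ : ∀ {L} → (∀ w → ¬ L w) → StarFreeRecognizable L
  sfr-∅ ∉L = sfr-ext (λ w → mk⇔ (λ w∉Σ* → ⊥-elim (w∉Σ* (∈Σ* w))) (λ w∈L → ⊥-elim (∉L w w∈L))) (sfr-compl sfr-Σ*)

-- Kleene's theorem (McNaughton–Yamada)

module _ {n : ℕ} {L : Lang (Fin n)} (R : Recognizer L) where
  open Recognizer R

  run : Q → Word (Fin n) → Q
  run = foldl δ

  Within : List Q → Q → Word (Fin n) → Set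
  Within S i []          = ⊤
  Within S i (a ∷ [])    = ⊤
  Within S i (a ∷ b ∷ w) = δ i a ∈ S × Within S (δ i a) (b ∷ w)

  -- Path S i j is the McNaughton–Yamada language R^S_ij: runs from i to j whose intermediate states lie in S.
  Path : List Q → Q → Q → Lang (Fin n)
  Path S i j w = run i w ≡ j × Within S i w

  within-weaken : ∀ m S i w → Within S i w → Within (m ∷ S) i w
  within-weaken m S i []          _          = tt
  within-weaken m S i (a ∷ [])    _          = tt
  within-weaken m S i (a ∷ b ∷ w) (a∈ , rest) = there a∈ , within-weaken m S (δ i a) (b ∷ w) rest

  within-∷ : ∀ S i a u → δ i a ∈ S → Within S (δ i a) u → Within S i (a ∷ u)
  within-∷ S i a []      _  _    = tt
  within-∷ S i a (b ∷ u) a∈ rest = a∈ , rest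

  within-++ : ∀ S i u v → Within S i u → run i u ∈ S → Within S (run i u) v → Within S i (u ++ v)
  within-++ S i []          v _           _  v-in = v-in
  within-++ S i (a ∷ [])    v _           m∈ v-in = within-∷ S i a v m∈ v-in
  within-++ S i (a ∷ b ∷ u) v (a∈ , rest) m∈ v-in = a∈ , within-++ S (δ i a) (b ∷ u) v rest m∈ v-in

  path-++ : ∀ S i m j u v → m ∈ S → Path S i m u → Path S m j v → Path S i j (u ++ v)
  path-++ S i m j u v m∈ (refl , u-in) (refl , v-in) = foldl-++ δ i u v , within-++ S i u v u-in m∈ v-in

  path-star : ∀ m S j us v → All (Path S m m) us → Path (m ∷ S) m j v → Path (m ∷ S) m j (concat us ++ v)
  path-star m S j []       v []                    P = P
  path-star m S j (u ∷ us) v ((u-run , u-in) ∷ Ps) P =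
    subst (Path (m ∷ S) m j) (sym (++-assoc u (concat us) v))
      (path-++ (m ∷ S) m m j u (concat us ++ v) (here refl) (u-run , within-weaken m S m u u-in) (path-star m S j us v Ps P))

  -- Cutting a run at its visits to m: R^(m∷S)_ij = R^S_ij ∪ R^S_im (R^S_mm)* R^S_mj.
  PathVia : Q → List Q → Q → Q → Lang (Fin n)
  PathVia m S i j = Path S i m ·ₗ (star (Path S m m) ·ₗ Path S m j)

  path-split : ∀ m S i j w → Path (m ∷ S) i j w → Path S i j w ⊎ PathVia m S i j w
  path-split m S i j []          (w-run , _) = inj₁ (w-run , tt)
  path-split m S i j (a ∷ [])    (w-run , _) = inj₁ (w-run , tt)
  path-split m S i j (a ∷ b ∷ w) (w-run , here refl , rest) with path-split m S (δ i a) j (b ∷ w) (w-run , rest)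
  ... | inj₁ P = inj₂ ([ a ] , b ∷ w , refl , (refl , tt) , [] , b ∷ w , refl , ([] , [] , refl) , P)
  ... | inj₂ (u , v , bw≡uv , Pu , s , t , v≡st , (us , Ps , s≡us) , Pt) =
        inj₂ ([ a ] , b ∷ w , refl , (refl , tt) , u ++ s , t ,
              trans bw≡uv (trans (cong (u ++_) v≡st) (sym (++-assoc u s t))) , (u ∷ us , Pu ∷ Ps , cong (u ++_) s≡us) , Pt)
  path-split m S i j (a ∷ b ∷ w) (w-run , there a∈ , rest) with path-split m S (δ i a) j (b ∷ w) (w-run , rest)
  ... | inj₁ (run′ , rest′) = inj₁ (run′ , a∈ , rest′)
  ... | inj₂ (u , v , bw≡uv , (u-run , u-in) , Pv) = inj₂ (a ∷ u , v , cong (a ∷_) bw≡uv , (u-run , within-∷ S i a u a∈ u-in) , Pv)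

  path-join : ∀ m S i j w → Path S i j w ⊎ PathVia m S i j w → Path (m ∷ S) i j w
  path-join m S i j w (inj₁ (w-run , w-in)) = w-run , within-weaken m S i w w-in
  path-join m S i j w (inj₂ (u , v , refl , (u-run , u-in) , s , t , refl , (us , Ps , refl) , (t-run , t-in))) =
    path-++ (m ∷ S) i m j u (concat us ++ t) (here refl) (u-run , within-weaken m S i u u-in)
      (path-star m S j us t Ps (t-run , within-weaken m S m t t-in))

  within? : ∀ S i → Decidable (Within S i)
  within? S i []          = yes tt
  within? S i (a ∷ [])    = yes tt
  within? S i (a ∷ b ∷ w) = Any.any? (δ i a ≟_) S ×-dec within? S (δ i a) (b ∷ w)

  path? : ∀ S i j → Decidable (Path S i j)
  path? S i j w = (run i w ≟ j) ×-dec within? S i w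

  regular-path-[] : ∀ i j → Regular (Path [] i j)
  regular-path-[] i j = re-ext short≐path (re-fin (filter (path? [] i j) short))
    where
    short : List (Word (Fin n))
    short = [] ∷ map [_] (allFin n)
    short≐path : finLang (filter (path? [] i j) short) ≐ Path [] i j
    short≐path w = mk⇔ (proj₂ ∘ ∈-filter⁻ (path? [] i j)) (λ P → ∈-filter⁺ (path? [] i j) (∈-short w P) P)
      where
      ∈-short : ∀ w → Path [] i j w → w ∈ short
      ∈-short []          _           = here refl
      ∈-short (a ∷ [])    _           = there (∈-map⁺ [_] (∈-allFin a))
      ∈-short (a ∷ b ∷ w) (_ , () , _)

  regular-path : ∀ S i j → Regular (Path S i j)
  regular-path []      i j = regular-path-[] i j
  regular-path (m ∷ S) i j = re-ext (λ w → mk⇔ (path-join m S i j w) (path-split m S i j w))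
    (re-union (regular-path S i j) (re-concat (regular-path S i m) (re-concat (re-star (regular-path S m m)) (regular-path S m j))))

  run-state : ∀ u w → run (state u) w ≡ state (u ++ w)
  run-state u []      = cong state (sym (++-identityʳ u))
  run-state u (a ∷ w) = begin
    run (δ (state u) a) w    ≡⟨ cong (λ q → run q w) (state-∷ʳ u a) ⟨
    run (state (u ++ [ a ])) w ≡⟨ run-state (u ++ [ a ]) w ⟩
    state ((u ++ [ a ]) ++ w) ≡⟨ cong state (++-assoc u [ a ] w) ⟩
    state (u ++ a ∷ w)       ∎
    where open ≡-Reasoning

  within-states : ∀ u w → Within states (state u) w
  within-states u []          = tt
  within-states u (a ∷ [])    = tt
  within-states u (a ∷ b ∷ w) =
    subst (_∈ states) (state-∷ʳ u a) (∈-states (u ++ [ a ])) ,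
    subst (λ q → Within states q (b ∷ w)) (state-∷ʳ u a) (within-states (u ++ [ a ]) (b ∷ w))

  PathFromStart : List Q → Lang (Fin n)
  PathFromStart js w = Any (λ j → Path states (state []) j w) js

  regular-path-from-start : ∀ js → Regular (PathFromStart js)
  regular-path-from-start []       = re-ext (λ w → mk⇔ (λ ()) (λ ())) (re-fin [])
  regular-path-from-start (j ∷ js) =
    re-ext (λ w → mk⇔ [ here , there ]′ (λ { (here P) → inj₁ P ; (there P) → inj₂ P }))
      (re-union (regular-path states (state []) j) (regular-path-from-start js))

  recognizer⇒regular : Regular L
  recognizer⇒regular = re-ext (≐-sym L≐) (regular-path-from-start accepting-states)
    where
    open Equivalence
    accepting-states : List Q
    accepting-states = filter (T? ∘ accepting) states
    L≐ : L ≐ PathFromStart accepting-states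
    L≐ w = mk⇔
      (λ w∈L → lose (∈-filter⁺ (T? ∘ accepting) (∈-states w) (to (recognizes w) w∈L))
                    (run-state [] w , within-states [] w))
      (λ P → let j , j∈ , j-run , _ = find P
             in from (recognizes w) (subst (T ∘ accepting) (trans (sym j-run) (run-state [] w))
                                           (proj₂ (∈-filter⁻ (T? ∘ accepting) {xs = states} j∈))))

-- Periodic languages

module _ {n : ℕ} (ρ : Word (Fin n)) {{_ : NonZero (length ρ)}} where
  open Periodic ρ

  HasPeriod : Lang (Fin n)
  HasPeriod x = ∀ y a v b z → x ≡ y ++ (a ∷ v) ++ b ∷ z → length (a ∷ v) ≡ p → a ≡ b

  PeriodDefect : Lang (Fin n)
  PeriodDefect w = ∃[ a ] ∃[ v ] ∃[ b ] w ≡ (a ∷ v) ++ [ b ] × length (a ∷ v) ≡ p × a ≢ b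

  period-defect? : Decidable PeriodDefect
  period-defect? w with initLast w
  ... | [] = no λ ()
  ... | [] ∷ʳ′ b = no λ (a , v , b′ , e , _) → case proj₁ (∷ʳ-injective [] (a ∷ v) e) of λ ()
  ... | (a ∷ v) ∷ʳ′ b with length (a ∷ v) ℕ.≟ p | a ≟ᶠ b
  ...   | yes |av|≡p | no a≢b = yes (a , v , b , refl , |av|≡p , a≢b)
  ...   | no |av|≢p  | _      = no λ (a′ , v′ , b′ , e , |av′|≡p , _) →
          |av|≢p (trans (cong length (proj₁ (∷ʳ-injective (a ∷ v) (a′ ∷ v′) e))) |av′|≡p)
  ...   | yes _      | yes a≡b = no λ (a′ , v′ , b′ , e , _ , a′≢b′) →
          let av≡ , b≡b′ = ∷ʳ-injective (a ∷ v) (a′ ∷ v′) e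
          in a′≢b′ (trans (sym (∷-injectiveˡ av≡)) (trans a≡b b≡b′))

  NoDefect : Lang (Fin n)
  NoDefect = compl (Σ* ·ₗ (PeriodDefect ·ₗ Σ*))

  HasPeriod⇒NoDefect : ∀ {x} → HasPeriod x → NoDefect x
  HasPeriod⇒NoDefect per (y , _ , e , _ , _ , z , refl , (a , v , b , refl , |av|≡p , a≢b) , _) =
    a≢b (per y a v b z (trans e (cong (y ++_) (++-assoc (a ∷ v) [ b ] z))) |av|≡p)

  NoDefect⇒HasPeriod : ∀ {x} → NoDefect x → HasPeriod x
  NoDefect⇒HasPeriod no-defect y a v b z e |av|≡p with a ≟ᶠ b
  ... | yes a≡b = a≡b
  ... | no a≢b  = ⊥-elim (no-defect (y , _ , trans e (cong (y ++_) (sym (++-assoc (a ∷ v) [ b ] z))) , ∈Σ* y ,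
                                     (a ∷ v) ++ [ b ] , z , refl , (a , v , b , refl , |av|≡p , a≢b) , ∈Σ* z))

  HasPeriod-∷ʳ⁻ : ∀ {x} c → HasPeriod (x ∷ʳ c) → HasPeriod x
  HasPeriod-∷ʳ⁻ c per y a v b z e |av|≡p = per y a v b (z ∷ʳ c) (begin
    _ ∷ʳ c                              ≡⟨ cong (_∷ʳ c) e ⟩
    (y ++ (a ∷ v) ++ b ∷ z) ++ [ c ]    ≡⟨ ++-assoc y _ [ c ] ⟩
    y ++ ((a ∷ v) ++ b ∷ z) ++ [ c ]    ≡⟨ cong (y ++_) (++-assoc (a ∷ v) (b ∷ z) [ c ]) ⟩
    y ++ (a ∷ v) ++ b ∷ z ∷ʳ c          ∎) |av|≡p
    where open ≡-Reasoning

  powers-HasPeriod : ∀ k → HasPeriod (ρ ^ k)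
  powers-HasPeriod k y a v b z e |av|≡p = begin
    a                         ≡⟨ applyUpTo-at ω (k * p) y a _ ωᵏᵖ≡ ⟩
    ω (length y)              ≡⟨ ω-+p (length y) ⟨
    ω (p + length y)          ≡⟨ cong ω (trans (+-comm p (length y)) (sym (trans (length-++ y) (cong (length y +_) |av|≡p)))) ⟩
    ω (length (y ++ a ∷ v))   ≡⟨ applyUpTo-at ω (k * p) (y ++ a ∷ v) b z (trans ωᵏᵖ≡ (sym (++-assoc y (a ∷ v) (b ∷ z)))) ⟨
    b                         ∎
    where
    open ≡-Reasoning
    ωᵏᵖ≡ : ω↾ (k * p) ≡ y ++ (a ∷ v) ++ b ∷ z
    ωᵏᵖ≡ = trans (ω↾-*p k) e

  ω↾-block : ∀ m → ∃[ a ] ∃[ v ] ω↾ (m + p) ≡ ω↾ m ++ a ∷ v × length (a ∷ v) ≡ p × a ≡ ω m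
  ω↾-block m with applyUpTo (ω ∘ (m +_)) p in block
  ... | []    = ⊥-elim (≢-nonZero⁻¹ p (trans (sym (length-applyUpTo _ p)) (cong length block)))
  ... | a ∷ v = a , v , trans (applyUpTo-+ ω m p) (cong (ω↾ m ++_) block) ,
                trans (cong length (sym block)) (length-applyUpTo _ p) ,
                trans (applyUpTo-at (ω ∘ (m +_)) p [] a v block) (cong ω (+-identityʳ m))

  Prefixω-of-HasPeriod : ∀ x → HasPeriod x → ρ ⊑ x ⊎ x ⊑ ρ → Prefixω x
  Prefixω-of-HasPeriod x = go (reverseView x)
    where
    go : ∀ {x} → Reverse x → HasPeriod x → ρ ⊑ x ⊎ x ⊑ ρ → Prefixω x
    go []            _   _   = refl
    go (x ∶ r ∶ʳ c) per cmp with length (x ∷ʳ c) ≤? p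
    ... | yes short = ⊑-applyUpTo ω p (subst (x ∷ʳ c ⊑_) (sym ω↾p) xc⊑ρ)
      where
      xc⊑ρ : x ∷ʳ c ⊑ ρ
      xc⊑ρ = [ (λ ρ⊑xc → ⊑-by-length (⊑-refl _) ρ⊑xc short) , id ]′ cmp
    ... | no long =
      let m , p+m≡x = m≤n⇒∃[o]m+o≡n p≤x
          a , v , ω↾≡ , |av|≡p , a≡ωm = ω↾-block m
          x≡ : x ≡ ω↾ m ++ a ∷ v
          x≡ = trans x∈ω (trans (cong ω↾_ (trans (sym p+m≡x) (+-comm p m))) ω↾≡)
          a≡c : a ≡ c
          a≡c = per (ω↾ m) a v c [] (trans (cong (_∷ʳ c) x≡) (++-assoc (ω↾ m) (a ∷ v) [ c ])) |av|≡p
      in Prefixω-∷ʳ⁺ x c x∈ω (begin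
           c                ≡⟨ a≡c ⟨
           a                ≡⟨ a≡ωm ⟩
           ω m              ≡⟨ ω-+p m ⟨
           ω (p + m)        ≡⟨ cong ω p+m≡x ⟩
           ω (length x)     ∎)
      where
      open ≡-Reasoning
      p≤x : p ≤ length x
      p≤x = s≤s⁻¹ (≤-trans (≰⇒> long) (≤-reflexive (length-∷ʳ x c)))
      ρ⊑x : ρ ⊑ x
      ρ⊑x = ⊑-by-length ([ id , (λ xc⊑ρ → ⊥-elim (long (⊑⇒length≤ xc⊑ρ))) ]′ cmp) (⊑-++ x [ c ]) p≤x
      x∈ω : Prefixω x
      x∈ω = go r (HasPeriod-∷ʳ⁻ c per) (inj₁ ρ⊑x)

  Powers : Lang (Fin n)
  Powers x = ∃[ k ] x ≡ ρ ^ k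

  ω↾-split : ∀ q → q < p → ∃[ t ] ρ ≡ ω↾ q ++ t × t ≢ []
  ω↾-split q q<p =
    applyUpTo (ω ∘ (q +_)) (p ∸ q) ,
    trans (sym ω↾p) (trans (cong ω↾_ (sym (m+[n∸m]≡n (<⇒≤ q<p)))) (applyUpTo-+ ω q (p ∸ q))) ,
    λ t≡[] → <⇒≢ (m<n⇒0<n∸m q<p) (sym (trans (sym (length-applyUpTo _ (p ∸ q))) (cong length t≡[])))

  -- If p does not divide |x|, the occurrences of ρ at both ends of x make ρ a proper rotation of itself.
  Prefixω-ending-in-ρ : Primitive ρ → ∀ x y → Prefixω x → x ≡ y ++ ρ → Powers x
  Prefixω-ending-in-ρ prim x y x∈ω x≡yρ = go (length x / p) (length x % p) (m%n<n (length x) p) x≡ρʲω↾q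
    where
    x≡ρʲω↾q : x ≡ ρ ^ (length x / p) ++ ω↾ (length x % p)
    x≡ρʲω↾q = trans x∈ω (trans (cong ω↾_ (trans (m≡m%n+[m/n]*n (length x) p) (+-comm (length x % p) _)))
                              (ω↾-*p+ (length x / p) (length x % p)))
    p≤x : p ≤ length x
    p≤x = ≤-trans (m≤n+m p (length y)) (≤-reflexive (sym (trans (cong length x≡yρ) (length-++ y))))
    go : ∀ j q → q < p → x ≡ ρ ^ j ++ ω↾ q → Powers x
    go j       zero    _   x≡ = j , trans x≡ (++-identityʳ _)
    go zero    (suc q) q<p x≡ = ⊥-elim (<⇒≱ q<p (subst (p ≤_) (trans (cong length x≡) (length-applyUpTo ω (suc q))) p≤x))
    go (suc j) (suc q) q<p x≡ with t , ρ≡rt , t≢[] ← ω↾-split (suc q) q<p =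
      ⊥-elim (prim r t (λ ()) t≢[] (sym ρ≡rt) (sym ρ≡tr))
      where
      open ≡-Reasoning
      r : Word (Fin n)
      r = ω↾ suc q
      x≡ρʲr·tr : x ≡ (ρ ^ j ++ r) ++ t ++ r
      x≡ρʲr·tr = begin
        x                        ≡⟨ x≡ ⟩
        ρ ^ suc j ++ r           ≡⟨ cong (_++ r) (^-sucʳ ρ j) ⟩
        (ρ ^ j ++ ρ) ++ r        ≡⟨ cong (λ σ → (ρ ^ j ++ σ) ++ r) ρ≡rt ⟩
        (ρ ^ j ++ r ++ t) ++ r   ≡⟨ ++-assoc (ρ ^ j) (r ++ t) r ⟩
        ρ ^ j ++ (r ++ t) ++ r   ≡⟨ cong (ρ ^ j ++_) (++-assoc r t r) ⟩
        ρ ^ j ++ r ++ t ++ r     ≡⟨ ++-assoc (ρ ^ j) r (t ++ r) ⟨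
        (ρ ^ j ++ r) ++ t ++ r   ∎
      ρ≡tr : ρ ≡ t ++ r
      ρ≡tr = ++-suffix-by-length y ρ (ρ ^ j ++ r) (t ++ r) (trans (sym x≡yρ) x≡ρʲr·tr)
               (trans (cong length ρ≡rt) (length-++-comm r t))

  -- ρ* = ε ∪ (ρΣ* ∩ Σ*ρ ∩ words of period p); this needs ρ primitive ((aa)* is not star-free).
  starFree-powers : Primitive ρ → StarFree Powers
  starFree-powers prim = sf-ext powers≐
    (sf-union (sf-fin _) (sf-inter (sf-concat (sf-fin _) Σ*-sf) (sf-inter (sf-concat Σ*-sf (sf-fin _))
      (sf-compl (sf-concat Σ*-sf (sf-concat (bounded-starFree (suc p) period-defect? defect-bounded) Σ*-sf))))))
    where
    Σ*-sf : StarFree Σ*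
    Σ*-sf = proj₁ sfr-Σ*
    defect-bounded : Bounded PeriodDefect (suc p)
    defect-bounded _ (a , v , b , refl , |av|≡p , _) = ≤-reflexive (trans (length-∷ʳ (a ∷ v) b) (cong suc |av|≡p))
    Expression : Lang (Fin n)
    Expression = finLang [ [] ] ∪ₗ ((finLang [ ρ ] ·ₗ Σ*) ∩ₗ ((Σ* ·ₗ finLang [ ρ ]) ∩ₗ NoDefect))
    powers≐ : Expression ≐ Powers
    powers≐ _ = mk⇔ from to
      where
      from : ∀ {x} → Expression x → Powers x
      from (inj₁ (here refl)) = 0 , refl
      from {x} (inj₂ ((_ , v , x≡ρv , here refl , _) , (y , _ , x≡yρ , _ , here refl) , no-defect)) =
        Prefixω-ending-in-ρ prim x y (Prefixω-of-HasPeriod x (NoDefect⇒HasPeriod no-defect) (inj₁ (v , x≡ρv))) x≡yρ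
      to : ∀ {x} → Powers x → Expression x
      to (zero  , refl) = inj₁ (here refl)
      to (suc k , refl) = inj₂ ((ρ , ρ ^ k , refl , here refl , ∈Σ* _) , (ρ ^ k , ρ , ^-sucʳ ρ k , ∈Σ* _ , here refl) ,
                                HasPeriod⇒NoDefect (powers-HasPeriod (suc k)))

  Prefixω? : Decidable Prefixω
  Prefixω? x = ≡-dec _≟ᶠ_ x (ω↾ length x)

  recognizer-Prefixω : Recognizer Prefixω
  recognizer-Prefixω = record
    { Q = Maybe ℕ ; _≟_ = Maybe.≡-dec ℕ._≟_
    ; state = state ; states = nothing ∷ map just (upTo p) ; ∈-states = ∈-states
    ; δ = δ ; state-∷ʳ = state-∷ʳ ; accepting = is-just ; recognizes = recognizes }
    where
    state : Word (Fin n) → Maybe ℕ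
    state x with Prefixω? x
    ... | yes _ = just (length x % p)
    ... | no _  = nothing
    δ : Maybe ℕ → Fin n → Maybe ℕ
    δ nothing  a = nothing
    δ (just i) a with a ≟ᶠ ω i
    ... | yes _ = just (suc i % p)
    ... | no _  = nothing
    ∈-states : ∀ x → state x ∈ nothing ∷ map just (upTo p)
    ∈-states x with Prefixω? x
    ... | yes _ = there (∈-map⁺ just (∈-upTo⁺ (m%n<n (length x) p)))
    ... | no _  = here refl
    recognizes : ∀ x → Prefixω x ⇔ T (is-just (state x))
    recognizes x with Prefixω? x
    ... | yes x∈ω = mk⇔ _ (λ _ → x∈ω)
    ... | no x∉ω  = mk⇔ x∉ω (λ ())
    state-∷ʳ : ∀ x a → state (x ∷ʳ a) ≡ δ (state x) a
    state-∷ʳ x a with Prefixω? x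
    state-∷ʳ x a | no x∉ω with Prefixω? (x ∷ʳ a)
    ... | yes xa∈ω = ⊥-elim (x∉ω (proj₁ (Prefixω-∷ʳ⁻ x a xa∈ω)))
    ... | no _     = refl
    state-∷ʳ x a | yes x∈ω with a ≟ᶠ ω (length x % p) | Prefixω? (x ∷ʳ a)
    ... | yes _  | yes _    = cong just (trans (cong (_% p) (length-∷ʳ x a)) (suc-% (length x)))
    ... | yes a≡ | no xa∉ω  = ⊥-elim (xa∉ω (Prefixω-∷ʳ⁺ x a x∈ω (trans a≡ (ω-% (length x)))))
    ... | no a≢  | yes xa∈ω = ⊥-elim (a≢ (trans (proj₂ (Prefixω-∷ʳ⁻ x a xa∈ω)) (sym (ω-% (length x)))))
    ... | no _   | no _     = refl

module _ {P : ℕ → Set} (P? : Decidable P) (M d : ℕ) {{_ : NonZero d}}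
         (periodic : ∀ ℓ → M ≤ ℓ → P (d + ℓ) ⇔ P ℓ) where

  P-*+ : ∀ k ℓ → M ≤ ℓ → P (k * d + ℓ) ⇔ P ℓ
  P-*+ zero    ℓ _   = mk⇔ id id
  P-*+ (suc k) ℓ M≤ℓ = P-*+ k ℓ M≤ℓ ⇔-∘ (periodic (k * d + ℓ) (≤-trans M≤ℓ (m≤n+m ℓ (k * d)))
                         ⇔-∘ mk⇔ (subst P (+-assoc d (k * d) ℓ)) (subst P (sym (+-assoc d (k * d) ℓ))))

  -- Lengths are counted exactly below M + d and then cyclically through M, …, M + d - 1.
  next : ℕ → ℕ
  next c with suc c <? M + d
  ... | yes _ = suc c
  ... | no _  = M

  class : ℕ → ℕ
  class zero    = 0
  class (suc ℓ) = next (class ℓ)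

  ClassOf : ℕ → ℕ → Set
  ClassOf ℓ c = c < M + d × ∃[ k ] ℓ ≡ k * d + c × (k ≡ 0 ⊎ M ≤ c)

  class-ClassOf : ∀ ℓ → ClassOf ℓ (class ℓ)
  class-ClassOf zero    = ≤-trans (>-nonZero⁻¹ d) (m≤n+m d M) , 0 , refl , inj₁ refl
  class-ClassOf (suc ℓ) with class ℓ | class-ClassOf ℓ
  ... | c | c< , k , ℓ≡ , k≡0⊎M≤c with suc c <? M + d
  ...   | yes c+1< = c+1< , k , trans (cong suc ℓ≡) (sym (+-suc (k * d) c)) , Sum.map₂ (λ M≤c → ≤-trans M≤c (n≤1+n c)) k≡0⊎M≤c
  ...   | no c+1≮  = m<m+n M (>-nonZero⁻¹ d) , suc k , (begin
      suc ℓ                ≡⟨ cong suc ℓ≡ ⟩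
      suc (k * d + c)      ≡⟨ +-suc (k * d) c ⟨
      k * d + suc c        ≡⟨ cong (k * d +_) (≤-antisym c< (≮⇒≥ c+1≮)) ⟩
      k * d + (M + d)      ≡⟨ cong (k * d +_) (+-comm M d) ⟩
      k * d + (d + M)      ≡⟨ +-assoc (k * d) d M ⟨
      k * d + d + M        ≡⟨ cong (_+ M) (+-comm (k * d) d) ⟩
      suc k * d + M        ∎) , inj₂ ≤-refl
    where open ≡-Reasoning

  P-class : ∀ ℓ → P (class ℓ) ⇔ P ℓ
  P-class ℓ with class-ClassOf ℓ
  ... | _ , k , ℓ≡ , inj₁ refl = mk⇔ (subst P (sym ℓ≡)) (subst P ℓ≡)
  ... | _ , k , ℓ≡ , inj₂ M≤c  = mk⇔ (subst P (sym ℓ≡)) (subst P ℓ≡) ⇔-∘ ⇔-sym (P-*+ k (class ℓ) M≤c)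

  recognizer-length : ∀ {n} → Recognizer {n} (P ∘ length)
  recognizer-length = record
    { Q = ℕ ; _≟_ = ℕ._≟_
    ; state = class ∘ length ; states = upTo (M + d) ; ∈-states = λ x → ∈-upTo⁺ (proj₁ (class-ClassOf (length x)))
    ; δ = λ c _ → next c ; state-∷ʳ = λ x a → cong class (length-∷ʳ x a)
    ; accepting = λ c → isYes (P? c)
    ; recognizes = λ x → mk⇔ (fromWitness ∘ Equivalence.from (P-class (length x))) (Equivalence.to (P-class (length x)) ∘ toWitness) }

module _ {n : ℕ} (ρ : Word (Fin n)) {{_ : NonZero (length ρ)}} (prim : Primitive ρ)
         {P : ℕ → Set} (P? : Decidable P) (J : ℕ)
         (periodic : ∀ ℓ → J * length ρ ≤ ℓ → P (length ρ + ℓ) ⇔ P ℓ) where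
  open Periodic ρ

  private
    M : ℕ
    M = J * p

    ω↾-beyond : ∀ k q → ω↾ (k * p + (M + q)) ≡ ρ ^ J ++ ρ ^ k ++ ω↾ q
    ω↾-beyond k q = begin
      ω↾ (k * p + (M + q))        ≡⟨ cong ω↾_ (+-assoc (k * p) M q) ⟨
      ω↾ (k * p + M + q)          ≡⟨ cong (λ i → ω↾ (i + q)) (trans (+-comm (k * p) M) (sym (*-distribʳ-+ p J k))) ⟩
      ω↾ ((J + k) * p + q)        ≡⟨ ω↾-*p+ (J + k) q ⟩
      ρ ^ (J + k) ++ ω↾ q         ≡⟨ cong (_++ ω↾ q) (^-+ ρ J k) ⟩
      (ρ ^ J ++ ρ ^ k) ++ ω↾ q    ≡⟨ ++-assoc (ρ ^ J) (ρ ^ k) (ω↾ q) ⟩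
      ρ ^ J ++ ρ ^ k ++ ω↾ q      ∎
      where open ≡-Reasoning

    Prefixω-ω↾ : ∀ ℓ → Prefixω (ω↾ ℓ)
    Prefixω-ω↾ ℓ = cong ω↾_ (sym (length-applyUpTo ω ℓ))

  -- Short words are listed; the rest is ρ^J followed by a power of ρ and a prefix of ρ shorter than ρ.
  starFree-Prefixω∩length : StarFree (Prefixω ∩ₗ (P ∘ length))
  starFree-Prefixω∩length = sf-ext decomposition≐
    (sf-union (sf-fin short) (sf-concat (sf-fin [ ρ ^ J ]) (sf-concat (starFree-powers ρ prim) (sf-fin tails))))
    where
    short tails : List (Word (Fin n))
    short = map ω↾_ (filter P? (upTo M))
    tails = map ω↾_ (filter (P? ∘ (M +_)) (upTo p))
    Decomposition : Lang (Fin n)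
    Decomposition = finLang short ∪ₗ (finLang [ ρ ^ J ] ·ₗ (Powers ρ ·ₗ finLang tails))
    decomposition≐ : Decomposition ≐ (Prefixω ∩ₗ (P ∘ length))
    decomposition≐ _ = mk⇔ from to
      where
      from : ∀ {x} → Decomposition x → (Prefixω ∩ₗ (P ∘ length)) x
      from (inj₁ x∈short) with ℓ , ℓ∈ , refl ← ∈-map⁻ ω↾_ x∈short =
        Prefixω-ω↾ ℓ , subst P (sym (length-applyUpTo ω ℓ)) (proj₂ (∈-filter⁻ P? {xs = upTo M} ℓ∈))
      from (inj₂ (_ , _ , refl , here refl , (_ , _ , refl , (k , refl) , y∈tails)))
        with q , q∈ , refl ← ∈-map⁻ ω↾_ y∈tails =
        subst (Prefixω ∩ₗ (P ∘ length)) (ω↾-beyond k q)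
          (Prefixω-ω↾ _ , subst P (sym (length-applyUpTo ω _))
            (Equivalence.from (P-*+ P? M p periodic k (M + q) (m≤m+n M q)) (proj₂ (∈-filter⁻ (P? ∘ (M +_)) {xs = upTo p} q∈))))
      to : ∀ {x} → (Prefixω ∩ₗ (P ∘ length)) x → Decomposition x
      to {x} (x∈ω , Px) with length x <? M
      ... | yes x<M = inj₁ (subst (_∈ short) (sym x∈ω) (∈-map⁺ ω↾_ (∈-filter⁺ P? (∈-upTo⁺ x<M) Px)))
      ... | no x≮M =
        let t , M+t≡x = m≤n⇒∃[o]m+o≡n (≮⇒≥ x≮M)
            k : ℕ
            k = t / p
            q : ℕ
            q = t % p
            x≡ : length x ≡ k * p + (M + q)
            x≡ = begin
              length x           ≡⟨ M+t≡x ⟨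
              M + t              ≡⟨ cong (M +_) (m≡m%n+[m/n]*n t p) ⟩
              M + (q + k * p)    ≡⟨ cong (M +_) (+-comm q (k * p)) ⟩
              M + (k * p + q)    ≡⟨ +-assoc M (k * p) q ⟨
              M + k * p + q      ≡⟨ cong (_+ q) (+-comm M (k * p)) ⟩
              k * p + M + q      ≡⟨ +-assoc (k * p) M q ⟩
              k * p + (M + q)    ∎
        in inj₂ (ρ ^ J , ρ ^ k ++ ω↾ q , trans x∈ω (trans (cong ω↾_ x≡) (ω↾-beyond k q)) , here refl ,
                 ρ ^ k , ω↾ q , refl , (k , refl) ,
                 ∈-map⁺ ω↾_ (∈-filter⁺ (P? ∘ (M +_)) (∈-upTo⁺ (m%n<n t p))
                   (Equivalence.to (P-*+ P? M p periodic k (M + q) (m≤m+n M q)) (subst P x≡ Px))))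
        where open ≡-Reasoning

  sfr-Prefixω∩length : StarFreeRecognizable (Prefixω ∩ₗ (P ∘ length))
  sfr-Prefixω∩length = starFree-Prefixω∩length , recognizer-∩ (recognizer-Prefixω ρ) (recognizer-length P? M p periodic)

-- Word equations in one unknown

data Symbol (A : Set) : Set where
  lit : A → Symbol A
  X   : Symbol A

Pattern : Set → Set
Pattern A = List (Symbol A)

module _ {A : Set} where

  infix 10 _⟨_⟩
  _⟨_⟩ : Pattern A → List A → List A
  []          ⟨ y ⟩ = []
  (lit a ∷ P) ⟨ y ⟩ = a ∷ P ⟨ y ⟩
  (X ∷ P)     ⟨ y ⟩ = y ++ P ⟨ y ⟩

  #X : Pattern A → ℕ
  #X []          = 0
  #X (lit _ ∷ P) = #X P
  #X (X ∷ P)     = suc (#X P)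

  #lit : Pattern A → ℕ
  #lit []          = 0
  #lit (lit _ ∷ P) = suc (#lit P)
  #lit (X ∷ P)     = #lit P

  constant : List A → Pattern A
  constant = map lit

  Solutions : Pattern A → Pattern A → Lang A
  Solutions P Q y = P ⟨ y ⟩ ≡ Q ⟨ y ⟩

  ⟨⟩-++ : ∀ P Q y → (P ++ Q) ⟨ y ⟩ ≡ P ⟨ y ⟩ ++ Q ⟨ y ⟩
  ⟨⟩-++ []          Q y = refl
  ⟨⟩-++ (lit a ∷ P) Q y = cong (a ∷_) (⟨⟩-++ P Q y)
  ⟨⟩-++ (X ∷ P)     Q y = trans (cong (y ++_) (⟨⟩-++ P Q y)) (sym (++-assoc y (P ⟨ y ⟩) (Q ⟨ y ⟩)))

  constant-⟨⟩ : ∀ c y → constant c ⟨ y ⟩ ≡ c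
  constant-⟨⟩ []      y = refl
  constant-⟨⟩ (a ∷ c) y = cong (a ∷_) (constant-⟨⟩ c y)

  constant-X-⟨⟩ : ∀ c Q y → (constant c ++ X ∷ Q) ⟨ y ⟩ ≡ c ++ y ++ Q ⟨ y ⟩
  constant-X-⟨⟩ c Q y = trans (⟨⟩-++ (constant c) (X ∷ Q) y) (cong (_++ y ++ Q ⟨ y ⟩) (constant-⟨⟩ c y))

  #X-constant-++ : ∀ c Q → #X (constant c ++ Q) ≡ #X Q
  #X-constant-++ []      Q = refl
  #X-constant-++ (a ∷ c) Q = #X-constant-++ c Q

  length-⟨⟩ : ∀ P y → length (P ⟨ y ⟩) ≡ #lit P + #X P * length y
  length-⟨⟩ []          y = refl
  length-⟨⟩ (lit a ∷ P) y = cong suc (length-⟨⟩ P y)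
  length-⟨⟩ (X ∷ P)     y = begin
    length (y ++ P ⟨ y ⟩)                 ≡⟨ length-++ y ⟩
    length y + length (P ⟨ y ⟩)           ≡⟨ cong (length y +_) (length-⟨⟩ P y) ⟩
    length y + (#lit P + #X P * length y) ≡⟨ +-assoc (length y) (#lit P) _ ⟨
    length y + #lit P + #X P * length y   ≡⟨ cong (_+ #X P * length y) (+-comm (length y) (#lit P)) ⟩
    #lit P + length y + #X P * length y   ≡⟨ +-assoc (#lit P) (length y) _ ⟩
    #lit P + (length y + #X P * length y) ∎
    where open ≡-Reasoning

  split-at-X : ∀ Q → 0 < #X Q → ∃[ c ] ∃[ Q′ ] Q ≡ constant c ++ X ∷ Q′
  split-at-X (lit a ∷ Q) 0<#X with c , Q′ , refl ← split-at-X Q 0<#X = a ∷ c , Q′ , refl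
  split-at-X (X ∷ Q)     _    = [] , Q , refl

  -- Compare lengths: #lit P + #X P · ℓ = #lit Q + #X Q · ℓ.
  solutions-bounded : ∀ P Q → #X P < #X Q → ∀ y → Solutions P Q y → length y ≤ #lit P
  solutions-bounded P Q #XP<#XQ y sol = +-cancelʳ-≤ (#X P * ℓ) ℓ (#lit P) (begin
    ℓ + #X P * ℓ                 ≡⟨⟩
    suc (#X P) * ℓ               ≤⟨ *-monoˡ-≤ ℓ #XP<#XQ ⟩
    #X Q * ℓ                     ≤⟨ m≤n+m (#X Q * ℓ) (#lit Q) ⟩
    #lit Q + #X Q * ℓ            ≡⟨ trans (sym (length-⟨⟩ Q y)) (trans (cong length (sym sol)) (length-⟨⟩ P y)) ⟩
    #lit P + #X P * ℓ            ∎)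
    where
    open ≤-Reasoning
    ℓ : ℕ
    ℓ = length y

  PowerSolves : List A → Pattern A → Pattern A → ℕ → Set
  PowerSolves ρ P Q j = Solutions P Q (ρ ^ j)

  expand : List A → Pattern A → Pattern A
  expand r []          = []
  expand r (lit a ∷ P) = lit a ∷ expand r P
  expand r (X ∷ P)     = X ∷ constant r ++ expand r P

  ⟨⟩-expand : ∀ y r P → P ⟨ y ++ r ⟩ ≡ expand r P ⟨ y ⟩
  ⟨⟩-expand y r []          = refl
  ⟨⟩-expand y r (lit a ∷ P) = cong (a ∷_) (⟨⟩-expand y r P)
  ⟨⟩-expand y r (X ∷ P)     = begin
    (y ++ r) ++ P ⟨ y ++ r ⟩                ≡⟨ ++-assoc y r _ ⟩
    y ++ r ++ P ⟨ y ++ r ⟩                  ≡⟨ cong (λ w → y ++ r ++ w) (⟨⟩-expand y r P) ⟩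
    y ++ r ++ expand r P ⟨ y ⟩              ≡⟨ cong (λ w → y ++ w ++ expand r P ⟨ y ⟩) (constant-⟨⟩ r y) ⟨
    y ++ constant r ⟨ y ⟩ ++ expand r P ⟨ y ⟩ ≡⟨ cong (y ++_) (⟨⟩-++ (constant r) (expand r P) y) ⟨
    y ++ (constant r ++ expand r P) ⟨ y ⟩   ∎
    where open ≡-Reasoning

  #X-expand : ∀ r P → #X (expand r P) ≡ #X P
  #X-expand r []          = refl
  #X-expand r (lit a ∷ P) = #X-expand r P
  #X-expand r (X ∷ P)     = cong suc (trans (#X-constant-++ r (expand r P)) (#X-expand r P))

EventuallyConstant : (ℕ → Set) → Set
EventuallyConstant E = ∃[ J ] ((∀ j → J ≤ j → E j) ⊎ (∀ j → J ≤ j → ¬ E j))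

EventuallyConstant-⇔ : ∀ {E F} → (∀ j → E j ⇔ F j) → EventuallyConstant F → EventuallyConstant E
EventuallyConstant-⇔ E⇔F (J , inj₁ always) = J , inj₁ λ j J≤j → Equivalence.from (E⇔F j) (always j J≤j)
EventuallyConstant-⇔ E⇔F (J , inj₂ never)  = J , inj₂ λ j J≤j → never j J≤j ∘ Equivalence.to (E⇔F j)

EventuallyConstant-step : ∀ {E} (ec : EventuallyConstant E) j → proj₁ ec ≤ j → E (suc j) ⇔ E j
EventuallyConstant-step (J , inj₁ always) j J≤j = mk⇔ (λ _ → always j J≤j) (λ _ → always (suc j) (m≤n⇒m≤1+n J≤j))
EventuallyConstant-step (J , inj₂ never)  j J≤j = mk⇔ (⊥-elim ∘ never (suc j) (m≤n⇒m≤1+n J≤j)) (⊥-elim ∘ never j J≤j)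

module _ {A : Set} (_≟_ : DecidableEquality A) {ρ : List A} (ρ≢[] : ρ ≢ []) (prim : Primitive ρ) where

  overlap-prefix : ∀ {c′ k} α γ → ρ ^ suc k ++ α ≡ c′ ++ ρ ++ γ → length c′ < k → c′ ++ ρ ⊑ ρ ^ suc k
  overlap-prefix {c′} {k} α γ e c′<k = ⊑-by-length (γ , trans e (sym (++-assoc c′ ρ γ))) (α , refl) (begin
    length (c′ ++ ρ)          ≡⟨ length-++ c′ ⟩
    length c′ + length ρ      ≤⟨ +-monoˡ-≤ (length ρ) (≤-trans (<⇒≤ c′<k) (^-length-≥ ρ≢[] k)) ⟩
    length (ρ ^ k) + length ρ ≡⟨ +-comm (length (ρ ^ k)) (length ρ) ⟩
    length ρ + length (ρ ^ k) ≡⟨ length-++ ρ ⟨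
    length (ρ ^ suc k)        ∎)
    where open ≤-Reasoning

  -- Either c′ is long enough to begin with ρ, or c′ρ ⊑ ρρ makes ρ a proper rotation of itself.
  no-overlap : ∀ {c′ k} α γ → c′ ≢ [] → ¬ ρ ⊑ c′ → length c′ < k → ρ ^ suc k ++ α ≢ c′ ++ ρ ++ γ
  no-overlap {c′} {suc k} α γ c′≢[] ρ⋢c′ c′<k e with length c′ <? length ρ
  ... | no c′≮ρ = ρ⋢c′ (⊑-by-length (⊑-++ ρ (ρ ^ suc k)) c′⊑P (≮⇒≥ c′≮ρ))
    where
    c′⊑P : c′ ⊑ ρ ^ suc (suc k)
    c′⊑P = ⊑-trans (⊑-++ c′ ρ) (overlap-prefix α γ e c′<k)
  ... | yes c′<ρ
    with t , ρ≡c′t ← ⊑-by-length (⊑-trans (⊑-++ c′ ρ) (overlap-prefix α γ e c′<k)) (⊑-++ ρ (ρ ^ suc k)) (<⇒≤ c′<ρ) =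
    prim c′ t c′≢[] t≢[] (sym ρ≡c′t) (sym ρ≡tc′)
    where
    c′ρ⊑ρρ : c′ ++ ρ ⊑ ρ ++ ρ
    c′ρ⊑ρρ = ⊑-by-length (overlap-prefix α γ e c′<k) (ρ ^ k , sym (++-assoc ρ ρ (ρ ^ k)))
               (≤-trans (≤-reflexive (length-++ c′))
                        (≤-trans (+-monoˡ-≤ (length ρ) (<⇒≤ c′<ρ)) (≤-reflexive (sym (length-++ ρ)))))
    ρ⊑tc′t : ρ ⊑ (t ++ c′) ++ t
    ρ⊑tc′t = subst (ρ ⊑_) (trans (cong (t ++_) ρ≡c′t) (sym (++-assoc t c′ t)))
               (⊑-cancelˡ c′ (subst (c′ ++ ρ ⊑_) (trans (cong (_++ ρ) ρ≡c′t) (++-assoc c′ t ρ)) c′ρ⊑ρρ))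
    ρ≡tc′ : ρ ≡ t ++ c′
    ρ≡tc′ = ⊑-length-≡ ρ⊑tc′t (t , refl) (trans (cong length ρ≡c′t) (length-++-comm c′ t))
    t≢[] : t ≢ []
    t≢[] refl = <-irrefl (sym (trans (cong length ρ≡c′t) (cong length (++-identityʳ c′)))) c′<ρ


  -- ρ^i and ρ^j commute, so the leading X and ρ^i cancel.
  X-vs-power : ∀ i P Q j →
    PowerSolves ρ (X ∷ P) (constant (ρ ^ i) ++ X ∷ Q) j ⇔ PowerSolves ρ P (constant (ρ ^ i) ++ Q) j
  X-vs-power i P Q j = mk⇔ (λ e → ++-cancelˡ y _ _ (trans e rhs≡)) (λ e → trans (cong (y ++_) e) (sym rhs≡))
    where
    open ≡-Reasoning
    y : List A
    y = ρ ^ j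
    rhs≡ : (constant (ρ ^ i) ++ X ∷ Q) ⟨ y ⟩ ≡ y ++ (constant (ρ ^ i) ++ Q) ⟨ y ⟩
    rhs≡ = begin
      (constant (ρ ^ i) ++ X ∷ Q) ⟨ y ⟩        ≡⟨ constant-X-⟨⟩ (ρ ^ i) Q y ⟩
      ρ ^ i ++ y ++ Q ⟨ y ⟩                    ≡⟨ ++-assoc (ρ ^ i) y _ ⟨
      (ρ ^ i ++ y) ++ Q ⟨ y ⟩                  ≡⟨ cong (_++ Q ⟨ y ⟩) (^-comm ρ i j) ⟩
      (y ++ ρ ^ i) ++ Q ⟨ y ⟩                  ≡⟨ ++-assoc y (ρ ^ i) _ ⟩
      y ++ ρ ^ i ++ Q ⟨ y ⟩                    ≡⟨ cong (λ w → y ++ w ++ Q ⟨ y ⟩) (constant-⟨⟩ (ρ ^ i) y) ⟨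
      y ++ constant (ρ ^ i) ⟨ y ⟩ ++ Q ⟨ y ⟩   ≡⟨ cong (y ++_) (⟨⟩-++ (constant (ρ ^ i)) Q y) ⟨
      y ++ (constant (ρ ^ i) ++ Q) ⟨ y ⟩       ∎

  X-vs-nonpower : ∀ i c′ P Q → c′ ≢ [] → ¬ ρ ⊑ c′ → ∀ j → i + suc (suc (length c′)) ≤ j →
    ¬ PowerSolves ρ (X ∷ P) (constant (ρ ^ i ++ c′) ++ X ∷ Q) j
  X-vs-nonpower i c′ P Q c′≢[] ρ⋢c′ j J≤j e =
    no-overlap (P ⟨ y ⟩) (ρ ^ (i + k) ++ Q ⟨ y ⟩) c′≢[] ρ⋢c′ (s≤s (m≤m+n (length c′) o))
      (++-cancelˡ (ρ ^ i) _ _ (begin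
        ρ ^ i ++ ρ ^ suc k ++ P ⟨ y ⟩        ≡⟨ ++-assoc (ρ ^ i) _ _ ⟨
        (ρ ^ i ++ ρ ^ suc k) ++ P ⟨ y ⟩      ≡⟨ cong (_++ P ⟨ y ⟩) (trans (sym (^-+ ρ i (suc k))) (cong (ρ ^_) j≡)) ⟩
        y ++ P ⟨ y ⟩                         ≡⟨ e ⟩
        (constant (ρ ^ i ++ c′) ++ X ∷ Q) ⟨ y ⟩ ≡⟨ constant-X-⟨⟩ (ρ ^ i ++ c′) Q y ⟩
        (ρ ^ i ++ c′) ++ y ++ Q ⟨ y ⟩        ≡⟨ ++-assoc (ρ ^ i) c′ _ ⟩
        ρ ^ i ++ c′ ++ y ++ Q ⟨ y ⟩          ≡⟨ cong (λ w → ρ ^ i ++ c′ ++ w ++ Q ⟨ y ⟩) (cong (ρ ^_) (trans (sym j≡) (+-suc i k))) ⟩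
        ρ ^ i ++ c′ ++ (ρ ++ ρ ^ (i + k)) ++ Q ⟨ y ⟩ ≡⟨ cong (λ w → ρ ^ i ++ c′ ++ w) (++-assoc ρ (ρ ^ (i + k)) _) ⟩
        ρ ^ i ++ c′ ++ ρ ++ ρ ^ (i + k) ++ Q ⟨ y ⟩ ∎))
    where
    open ≡-Reasoning
    y : List A
    y = ρ ^ j
    o : ℕ
    o = proj₁ (m≤n⇒∃[o]m+o≡n J≤j)
    k : ℕ
    k = suc (length c′ + o)
    j≡ : i + suc k ≡ j
    j≡ = trans (sym (+-assoc i (suc (suc (length c′))) o)) (proj₂ (m≤n⇒∃[o]m+o≡n J≤j))

  eventually-constant : ∀ P Q → #X P ≡ #X Q → EventuallyConstant (PowerSolves ρ P Q)
  eventually-constant P Q #X≡ = go (#X P) P Q refl (sym #X≡)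
    where
    -- Recursion on the number k of occurrences of X, and within fixed k on the left pattern.
    always : ∀ {E : ℕ → Set} → (∀ j → E j) → EventuallyConstant E
    always E = 0 , inj₁ λ j _ → E j
    never : ∀ {E : ℕ → Set} → (∀ j → ¬ E j) → EventuallyConstant E
    never ¬E = 0 , inj₂ λ j _ → ¬E j

    X-vs-constant : ∀ {k} → (∀ P Q → #X P ≡ k → #X Q ≡ k → EventuallyConstant (PowerSolves ρ P Q)) →
      ∀ P c Q → c ≢ [] → #X P ≡ k → #X Q ≡ k → EventuallyConstant (PowerSolves ρ (X ∷ P) (constant c ++ X ∷ Q))
    X-vs-constant rec P c Q c≢[] hP hQ with strip-powers _≟_ ρ ρ≢[] c
    ... | i , [] , refl , _ =
      EventuallyConstant-⇔
        (λ j → subst (λ c → PowerSolves ρ (X ∷ P) (constant c ++ X ∷ Q) j ⇔ PowerSolves ρ P (constant (ρ ^ i) ++ Q) j)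
                     (sym (++-identityʳ (ρ ^ i))) (X-vs-power i P Q j))
        (rec P (constant (ρ ^ i) ++ Q) hP (trans (#X-constant-++ (ρ ^ i) Q) hQ))
    ... | i , c′@(_ ∷ _) , refl , ρ⋢c′ = i + suc (suc (length c′)) , inj₂ (X-vs-nonpower i c′ P Q (λ ()) ρ⋢c′)

    go : ∀ k P Q → #X P ≡ k → #X Q ≡ k → EventuallyConstant (PowerSolves ρ P Q)
    go k       []          []          _    _    = always λ _ → refl
    go k       []          (lit b ∷ Q) _    _    = never λ _ ()
    go k       (lit a ∷ P) []          _    _    = never λ _ ()
    go k       []          (X ∷ Q)     refl ()
    go k       (X ∷ P)     []          ()   refl
    go k       (lit a ∷ P) (lit b ∷ Q) hP   hQ   with a ≟ b
    ... | yes refl = EventuallyConstant-⇔ (λ j → mk⇔ ∷-injectiveʳ (cong (a ∷_))) (go k P Q hP hQ)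
    ... | no a≢b   = never λ j e → a≢b (∷-injectiveˡ e)
    go zero    (X ∷ P)     _           ()   _
    go zero    (lit a ∷ P) (X ∷ Q)     _    ()
    go (suc k) (X ∷ P)     (X ∷ Q)     hP   hQ   =
      EventuallyConstant-⇔ (λ j → mk⇔ (++-cancelˡ (ρ ^ j) _ _) (cong (ρ ^ j ++_))) (go k P Q (suc-injective hP) (suc-injective hQ))
    go (suc k) (X ∷ P)     (lit b ∷ Q) hP   hQ   with c , Q′ , refl ← split-at-X Q (subst (0 <_) (sym hQ) (s≤s z≤n)) =
      X-vs-constant (go k) P (b ∷ c) Q′ (λ ()) (suc-injective hP) (suc-injective (trans (sym (#X-constant-++ c (X ∷ Q′))) hQ))
    go (suc k) (lit a ∷ P) (X ∷ Q)     hP   hQ   with c , P′ , refl ← split-at-X P (subst (0 <_) (sym hP) (s≤s z≤n)) =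
      EventuallyConstant-⇔ (λ j → mk⇔ sym sym)
        (X-vs-constant (go k) Q (a ∷ c) P′ (λ ()) (suc-injective hQ) (suc-injective (trans (sym (#X-constant-++ c (X ∷ P′))) hP)))

upper-bound : ∀ (f : ℕ → ℕ) r → ∃[ J ] ∀ q → q < r → f q ≤ J
upper-bound f zero    = 0 , λ _ ()
upper-bound f (suc r) with J , bound ← upper-bound f r = f r ⊔ J , below
  where
  below : ∀ q → q < suc r → f q ≤ f r ⊔ J
  below q q<1+r with m<1+n⇒m<n∨m≡n q<1+r
  ... | inj₁ q<r  = ≤-trans (bound q q<r) (m≤n⊔m (f r) J)
  ... | inj₂ refl = m≤m⊔n (f q) J

-- Quantifier-free definable languages

module _ {n : ℕ} where

  Solutions? : ∀ (P Q : Pattern (Fin n)) → Decidable (Solutions P Q)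
  Solutions? P Q y = ≡-dec _≟ᶠ_ (P ⟨ y ⟩) (Q ⟨ y ⟩)

  module _ (ρ : Word (Fin n)) {{_ : NonZero (length ρ)}} (prim : Primitive ρ) where
    open Periodic ρ

    Solutions-^-++ : ∀ P Q j r → Solutions P Q (ρ ^ j ++ r) ⇔ PowerSolves ρ (expand r P) (expand r Q) j
    Solutions-^-++ P Q j r = mk⇔ (λ e → trans (sym (⟨⟩-expand (ρ ^ j) r P)) (trans e (⟨⟩-expand (ρ ^ j) r Q)))
                                 (λ e → trans (⟨⟩-expand (ρ ^ j) r P) (trans e (sym (⟨⟩-expand (ρ ^ j) r Q))))

    -- Writing ℓ = j p + q, the q-th residue class is eventually constant in j; take the largest threshold.
    solutions-eventually-periodic : ∀ P Q → #X P ≡ #X Q →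
      ∃[ J ] ∀ ℓ → J * p ≤ ℓ → Solutions P Q (ω↾ (p + ℓ)) ⇔ Solutions P Q (ω↾ ℓ)
    solutions-eventually-periodic P Q #X≡ = J , periodic
      where
      ec : ∀ q → EventuallyConstant (PowerSolves ρ (expand (ω↾ q) P) (expand (ω↾ q) Q))
      ec q = eventually-constant _≟ᶠ_ ρ≢[] prim (expand (ω↾ q) P) (expand (ω↾ q) Q)
               (trans (#X-expand (ω↾ q) P) (trans #X≡ (sym (#X-expand (ω↾ q) Q))))
      J : ℕ
      J = proj₁ (upper-bound (proj₁ ∘ ec) p)
      periodic : ∀ ℓ → J * p ≤ ℓ → Solutions P Q (ω↾ (p + ℓ)) ⇔ Solutions P Q (ω↾ ℓ)
      periodic ℓ Jp≤ℓ =
        ⇔-sym (sol-at j ℓ ℓ≡) ⇔-∘ (EventuallyConstant-step (ec q) j threshold≤j ⇔-∘ sol-at (suc j) (p + ℓ) p+ℓ≡)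
        where
        q : ℕ
        q = ℓ % p
        j : ℕ
        j = ℓ / p
        ℓ≡ : ℓ ≡ j * p + q
        ℓ≡ = trans (m≡m%n+[m/n]*n ℓ p) (+-comm q (j * p))
        p+ℓ≡ : p + ℓ ≡ suc j * p + q
        p+ℓ≡ = trans (cong (p +_) ℓ≡) (sym (+-assoc p (j * p) q))
        sol-at : ∀ i m → m ≡ i * p + q → Solutions P Q (ω↾ m) ⇔ PowerSolves ρ (expand (ω↾ q) P) (expand (ω↾ q) Q) i
        sol-at i m m≡ = Solutions-^-++ P Q i (ω↾ q) ⇔-∘ mk⇔ (subst (Solutions P Q) ω↾m≡) (subst (Solutions P Q) (sym ω↾m≡))
          where
          ω↾m≡ : ω↾ m ≡ ρ ^ i ++ ω↾ q
          ω↾m≡ = trans (cong ω↾_ m≡) (ω↾-*p+ i q)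
        J≤j : J ≤ j
        J≤j = s≤s⁻¹ (*-cancelʳ-< p J (suc j) (begin-strict
          J * p        ≤⟨ Jp≤ℓ ⟩
          ℓ            ≡⟨ ℓ≡ ⟩
          j * p + q    <⟨ +-monoʳ-< (j * p) (m%n<n ℓ p) ⟩
          j * p + p    ≡⟨ +-comm (j * p) p ⟩
          suc j * p    ∎))
          where open ≤-Reasoning
        threshold≤j : proj₁ (ec q) ≤ j
        threshold≤j = ≤-trans (proj₂ (upper-bound (proj₁ ∘ ec) p) q (m%n<n ℓ p)) J≤j

  -- Every solution x is a prefix of c x, hence of ρ^ω for the primitive root ρ of c, so only its length matters.
  sfr-X-vs-constant : ∀ P c Q → c ≢ [] → #X (X ∷ P) ≡ #X (constant c ++ X ∷ Q) →
                      StarFreeRecognizable (Solutions (X ∷ P) (constant c ++ X ∷ Q))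
  sfr-X-vs-constant P c Q c≢[] #X≡ with primitive-root _≟ᶠ_ c c≢[]
  ... | [] , _ , ρ≢[] , _ = ⊥-elim (ρ≢[] refl)
  ... | ρ@(_ ∷ _) , j , _ , prim , c≡ρʲ with k , refl ← ^-nonempty ρ j (c≢[] ∘ trans c≡ρʲ) =
    sfr-ext solutions≐ (sfr-Prefixω∩length ρ prim (Solutions? lhs rhs ∘ ω↾_) J periodic)
    where
    open Periodic ρ
    lhs rhs : Pattern (Fin n)
    lhs = X ∷ P
    rhs = constant c ++ X ∷ Q
    J : ℕ
    J = proj₁ (solutions-eventually-periodic ρ prim lhs rhs #X≡)
    periodic : ∀ ℓ → J * p ≤ ℓ → Solutions lhs rhs (ω↾ (p + ℓ)) ⇔ Solutions lhs rhs (ω↾ ℓ)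
    periodic = proj₂ (solutions-eventually-periodic ρ prim lhs rhs #X≡)
    solution⇒Prefixω : ∀ x → Solutions lhs rhs x → Prefixω x
    solution⇒Prefixω x sol = ⊑-power⇒Prefixω k x (subst (λ c → x ⊑ c ++ x) c≡ρʲ x⊑cx)
      where
      x⊑cx : x ⊑ c ++ x
      x⊑cx = ⊑-by-length (P ⟨ x ⟩ , sym sol) (Q ⟨ x ⟩ , trans (constant-X-⟨⟩ c Q x) (sym (++-assoc c x (Q ⟨ x ⟩))))
               (≤-trans (m≤n+m (length x) (length c)) (≤-reflexive (sym (length-++ c))))
    solutions≐ : (Prefixω ∩ₗ (Solutions lhs rhs ∘ ω↾_ ∘ length)) ≐ Solutions lhs rhs
    solutions≐ x = mk⇔ (λ (x∈ω , sol) → subst (Solutions lhs rhs) (sym x∈ω) sol)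
                       (λ sol → solution⇒Prefixω x sol , subst (Solutions lhs rhs) (solution⇒Prefixω x sol) sol)

  sfr-balanced : ∀ P Q → #X P ≡ #X Q → StarFreeRecognizable (Solutions P Q)
  sfr-balanced []          []          _   = sfr-ext (λ _ → mk⇔ (λ _ → refl) (λ _ → ∈Σ* _)) sfr-Σ*
  sfr-balanced []          (lit b ∷ Q) _   = sfr-∅ λ _ ()
  sfr-balanced (lit a ∷ P) []          _   = sfr-∅ λ _ ()
  sfr-balanced (lit a ∷ P) (lit b ∷ Q) #X≡ with a ≟ᶠ b
  ... | yes refl = sfr-ext (λ _ → mk⇔ (cong (a ∷_)) ∷-injectiveʳ) (sfr-balanced P Q #X≡)
  ... | no a≢b   = sfr-∅ λ _ e → a≢b (∷-injectiveˡ e)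
  sfr-balanced (X ∷ P)     (X ∷ Q)     #X≡ =
    sfr-ext (λ y → mk⇔ (cong (y ++_)) (++-cancelˡ y _ _)) (sfr-balanced P Q (suc-injective #X≡))
  sfr-balanced (X ∷ P)     (lit b ∷ Q) #X≡ with c , Q′ , refl ← split-at-X Q (subst (0 <_) #X≡ (s≤s z≤n)) =
    sfr-X-vs-constant P (b ∷ c) Q′ (λ ()) #X≡
  sfr-balanced (lit a ∷ P) (X ∷ Q)     #X≡ with c , P′ , refl ← split-at-X P (subst (0 <_) (sym #X≡) (s≤s z≤n)) =
    sfr-ext (λ _ → mk⇔ sym sym) (sfr-X-vs-constant Q (a ∷ c) P′ (λ ()) (sym #X≡))

  sfr-solutions : ∀ P Q → StarFreeRecognizable (Solutions P Q)
  sfr-solutions P Q with <-cmp (#X P) (#X Q)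
  ... | tri< #XP<#XQ _ _ = sfr-bounded (#lit P) (Solutions? P Q) (solutions-bounded P Q #XP<#XQ)
  ... | tri≈ _ #X≡ _     = sfr-balanced P Q #X≡
  ... | tri> _ _ #XQ<#XP = sfr-bounded (#lit Q) (Solutions? P Q) (λ y → solutions-bounded Q P #XQ<#XP y ∘ sym)

  pattern-of : ∀ {m} → Term {Fin n} (suc m) → (Fin m → Word (Fin n)) → Pattern (Fin n)
  pattern-of (var Fin.zero)    as = [ X ]
  pattern-of (var (Fin.suc i)) as = constant (as i)
  pattern-of eps           as = []
  pattern-of (s ∙ t)       as = pattern-of s as ++ pattern-of t as

  ⟦⟧t-pattern-of : ∀ {m} (t : Term (suc m)) as x → ⟦ t ⟧t (x ◃ as) ≡ pattern-of t as ⟨ x ⟩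
  ⟦⟧t-pattern-of (var Fin.zero)    as x = sym (++-identityʳ x)
  ⟦⟧t-pattern-of (var (Fin.suc i)) as x = sym (constant-⟨⟩ (as i) x)
  ⟦⟧t-pattern-of eps           as x = refl
  ⟦⟧t-pattern-of (s ∙ t)       as x =
    trans (cong₂ _++_ (⟦⟧t-pattern-of s as x) (⟦⟧t-pattern-of t as x)) (sym (⟨⟩-++ (pattern-of s as) (pattern-of t as) x))

  sfr-definable : ∀ {m} (as : Fin m → Word (Fin n)) (φ : QFFormula (suc m)) → StarFreeRecognizable (λ x → (x ◃ as) ⊨ φ)
  sfr-definable as ⊤f       = sfr-ext (λ x → mk⇔ _ (λ _ → ∈Σ* x)) sfr-Σ*
  sfr-definable as (s ≐t t) = sfr-ext (λ x → mk⇔ (λ e → trans (⟦⟧t-pattern-of s as x) (trans e (sym (⟦⟧t-pattern-of t as x))))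
                                                  (λ e → trans (sym (⟦⟧t-pattern-of s as x)) (trans e (⟦⟧t-pattern-of t as x))))
                                      (sfr-solutions (pattern-of s as) (pattern-of t as))
  sfr-definable as (¬f φ)   = sfr-compl (sfr-definable as φ)
  sfr-definable as (φ ∧f ψ) = sfr-∩ (sfr-definable as φ) (sfr-definable as ψ)
  sfr-definable as (φ ∨f ψ) = sfr-∪ (sfr-definable as φ) (sfr-definable as ψ)

proposition3p5 : (n : ℕ) (L : Lang (Fin n)) → QFDefinable L → StarFree L × Regular L
proposition3p5 n L (m , φ , as , L≐φ) =
  let starFree , recognizer = sfr-definable as φ
  in sf-ext (≐-sym L≐φ) starFree , re-ext (≐-sym L≐φ) (recognizer⇒regular recognizer)
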